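{- Let $n\in\mathbb{N}$, let $\alpha=(\alpha_1,\dots,\alpha_m)$ be a composition of $n$, let $T$ be a linear extension of $D(\alpha)$, and let $\pi\in S_n'$. Then $T=T_\pi$ if and only if both of the following hold: (a) $(T^{ -1}(1,j))_{j=1}^{m}$ is a subsequence of $\pi$; and (b) for every $(i,j)\in D(\alpha)$ with $i>1$, the entry $T^{ -1}(i,j)$ lies in $B_{\pi,T}(i,j,1)$.
   Context: A "permutation" may be any finite sequence of distinct integers. West's stack-sorting map $s$: read the input left to right with an initially empty stack; repeatedly, if the input is nonempty and either the stack is empty or the top of the stack is greater than the next input entry, push the next entry; otherwise pop the top of the stack and append it to the output; stop when input and stack are empty. $\operatorname{sc}(\pi)$ is the least $k\ge0$ with $s^k(\pi)$ increasing. $S_n'$ is the set of permutations of $\{0,1,\dots,n\}$ whose last entry is $0$. For $\pi\in S_n'$ and $1\le i\le\operatorname{sc}(\pi)$ let $\sigma=s^{i-1}(\pi)$. Let $c_{\pi,i,1}$ be the maximum of the entries of $\sigma$ strictly left of $0$; for $j\ge2$, as long as some entry of $\sigma$ lies strictly between $c_{\pi,i,j-1}$ and $0$, let $c_{\pi,i,j}$ be the maximum of those entries; otherwise stop. This gives $C_{\pi,i}=(c_{\pi,i,1},\dots,c_{\pi,i,|C_{\pi,i}|})$. Blocks: $b_{\pi,i,1}$ is the contiguous subsequence of $\sigma$ strictly before $c_{\pi,i,1}$, and $b_{\pi,i,j}$ ($j\ge2$) the contiguous subsequence strictly between $c_{\pi,i,j-1}$ and $c_{\pi,i,j}$. Every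 $x\in[n]$ equals $c_{\pi,i,j}$ for a unique pair $(i,j)$; set $\operatorname{col}_\pi(x)=i$, $\operatorname{colpos}_\pi(x)=j$. If $\operatorname{col}_\pi(x)>1$, there is a unique $j$ with $x=\max(b_{\pi,\operatorname{col}_\pi(x)-1,j})$, and $\operatorname{leftof}_\pi(x):=c_{\pi,\operatorname{col}_\pi(x)-1,j}$. Recursively $\operatorname{row}_\pi(x)=\operatorname{colpos}_\pi(x)$ if $\operatorname{col}_\pi(x)=1$, and $\operatorname{row}_\pi(x)=\operatorname{row}_\pi(\operatorname{leftof}_\pi(x))$ otherwise. The composition $\alpha_\pi=(|\{x\in[n]:\operatorname{row}_\pi(x)=j\}|)_{j=1}^{|C_{\pi,1}|}$. For a composition $\alpha=(\alpha_1,\dots,\alpha_m)$, $D(\alpha)=\{(i,j)\in\mathbb{N}^2: 1\le j\le m,\ i\le\alpha_j\}$, with partial order $(a,b)\ge_D(c,d)$ iff $a\le c$ and $b\le d$. $T_\pi:[n]\to D(\alpha_\pi)$, $T_\pi(x)=(\operatorname{col}_\pi(x),\operatorname{row}_\pi(x))$. A linear extension of $D(\alpha)$ is a bijection $T:[n]\to D(\alpha)$ such that $T(x)\ge_D T(y)$ implies $x\ge y$. The equality $T=T_\pi$ means equality as functions on $[n]$ (in particular $D(\alpha)=D(\alpha_\pi)$). For $(i,j)\in D(\alpha)$ with $i>1$, let $r=\max\{j'<j:\alpha_{j'}\ge i-1\}$ (with $r=0$ if this set is empty). Then $B_{\pi,T}(i,j,1)$ is the contiguous subsequence of $\pi$ consisting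 of the entries strictly after $T^{ -1}(1,r)$ up to and including $T^{ -1}(1,j)$ if $r>0$, and of the entries from the beginning of $\pi$ up to and including $T^{ -1}(1,j)$ if $r=0$. -}

module Defs where

open import Data.Nat using (ℕ; zero; suc; _≤_; _<_; _⊔_; _≡ᵇ_; _<ᵇ_; _≤ᵇ_)
open import Data.Bool using (Bool; true; false; if_then_else_; _∧_)
open import Data.List using (List; []; _∷_; _++_; length; map; foldr; upTo; filter)
open import Data.Nat.ListAction using (sum)
open import Data.List.Relation.Unary.All using (All)
open import Data.List.Relation.Binary.Permutation.Propositional using (_↭_)
open import Data.List.Relation.Binary.Sublist.Propositional using (_⊆_)
open import Data.List.Membership.Propositional using (_∈_)
open import Data.Maybe using (Maybe; just; nothing; _>>=_)
import Data.Maybe as Maybe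
open import Data.Product using (_×_; _,_; proj₁; proj₂; ∃)
open import Relation.Binary.PropositionalEquality using (_≡_)

oneTo : ℕ → List ℕ
oneTo k = map suc (upTo k)

-- 1-indexed lookup, 0 outside the range
at : List ℕ → ℕ → ℕ
at []       _             = 0
at (a ∷ as) zero          = 0
at (a ∷ as) (suc zero)    = a
at (a ∷ as) (suc (suc j)) = at as (suc j)

firstJust : {A : Set} → List ℕ → (ℕ → Maybe A) → Maybe (ℕ × A)
firstJust []       f = nothing
firstJust (k ∷ ks) f with f k
... | just a  = just (k , a)
... | nothing = firstJust ks f

cut : ℕ → List ℕ → List ℕ × List ℕ
cut y [] = [] , []
cut y (x ∷ xs) =
  if x ≡ᵇ y then ([] , xs)
  else (x ∷ proj₁ (cut y xs) , proj₂ (cut y xs))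

throughIncl : ℕ → List ℕ → List ℕ
throughIncl y [] = []
throughIncl y (x ∷ xs) = if x ≡ᵇ y then x ∷ [] else x ∷ throughIncl y xs

strictlyAfter : ℕ → List ℕ → List ℕ
strictlyAfter y [] = []
strictlyAfter y (x ∷ xs) = if x ≡ᵇ y then xs else strictlyAfter y xs

increasing : List ℕ → Bool
increasing []           = true
increasing (x ∷ [])     = true
increasing (x ∷ y ∷ xs) = (x <ᵇ y) ∧ increasing (y ∷ xs)

count : (ℕ → Bool) → List ℕ → ℕ
count p []       = 0
count p (x ∷ xs) = if p x then suc (count p xs) else count p xs

eqMaybe : Maybe ℕ → ℕ → Bool
eqMaybe nothing  _ = false
eqMaybe (just a) b = a ≡ᵇ b

-- West's stack-sorting map

stackRun : List ℕ → List ℕ → List ℕ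
stackRun []       st       = st
stackRun (x ∷ xs) []       = stackRun xs (x ∷ [])
stackRun (x ∷ xs) (t ∷ st) =
  if x <ᵇ t then stackRun xs (x ∷ t ∷ st)
  else t ∷ stackRun (x ∷ xs) st

s : List ℕ → List ℕ
s π = stackRun π []

iter : ℕ → List ℕ → List ℕ
iter zero    σ = σ
iter (suc k) σ = iter k (s σ)

scAux : ℕ → List ℕ → ℕ
scAux zero    σ = 0
scAux (suc f) σ = if increasing σ then 0 else suc (scAux f (s σ))

-- sc(π); it is classical that s^(length π) π is increasing, so the fuel suffices
sc : List ℕ → ℕ
sc π = scAux (length π) π

-- chain fuel ρ : for ρ the entries left of 0, the list of pairs (b_j , c_j):
-- c_1 = max ρ, c_j = max of the entries after c_{j-1}; b_j the entries
-- strictly between c_{j-1} and c_j.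
chain : ℕ → List ℕ → List (List ℕ × ℕ)
chain zero    _        = []
chain (suc f) []       = []
chain (suc f) (x ∷ xs) =
  let m = foldr _⊔_ x xs in
  (proj₁ (cut m (x ∷ xs)) , m) ∷ chain f (proj₂ (cut m (x ∷ xs)))

-- the pairs (b_{π,i,j} , c_{π,i,j}) for j = 1, 2, … , with σ = s^(i-1)(π)
layer : List ℕ → ℕ → List (List ℕ × ℕ)
layer π i = chain (length σ) (proj₁ (cut 0 σ))
  where σ = iter (i Data.Nat.∸ 1) π

posIn : ℕ → List (List ℕ × ℕ) → Maybe ℕ
posIn x [] = nothing
posIn x ((b , c) ∷ r) = if c ≡ᵇ x then just 1 else Maybe.map suc (posIn x r)

owner : ℕ → List (List ℕ × ℕ) → Maybe ℕ
owner x [] = nothing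
owner x (([] , c) ∷ r) = owner x r
owner x ((y ∷ ys , c) ∷ r) = if foldr _⊔_ y ys ≡ᵇ x then just c else owner x r

-- (col_π(x) , colpos_π(x)), searching 1 ≤ i ≤ sc(π)
coord : List ℕ → ℕ → Maybe (ℕ × ℕ)
coord π x = firstJust (oneTo (sc π)) (λ i → posIn x (layer π i))

-- rowAux π i x = row_π(x) for x with col_π(x) = i
rowAux : List ℕ → ℕ → ℕ → Maybe ℕ
rowAux π zero          x = nothing
rowAux π (suc zero)    x = posIn x (layer π 1)
rowAux π (suc (suc k)) x = owner x (layer π (suc k)) >>= rowAux π (suc k)

row : List ℕ → ℕ → Maybe ℕ
row π x = coord π x >>= λ p → rowAux π (proj₁ p) x

Tπ : List ℕ → ℕ → Maybe (ℕ × ℕ)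
Tπ π x = coord π x >>= λ p → Maybe.map (λ r → (proj₁ p , r)) (rowAux π (proj₁ p) x)

απ : ℕ → List ℕ → List ℕ
απ n π = map (λ j → count (λ x → eqMaybe (row π x) j) (oneTo n)) (oneTo (length (layer π 1)))

IsComposition : ℕ → List ℕ → Set
IsComposition n α = All (λ a → 1 ≤ a) α × sum α ≡ n

InD : List ℕ → ℕ × ℕ → Set
InD α (i , j) = 1 ≤ i × 1 ≤ j × j ≤ length α × i ≤ at α j

_≥D_ : ℕ × ℕ → ℕ × ℕ → Set
(a , b) ≥D (c , d) = a ≤ c × b ≤ d

-- T : [n] → D(α) is a bijection and T x ≥_D T y ⇒ x ≥ y (values outside [n] irrelevant)
IsLinearExtension : ℕ → List ℕ → (ℕ → ℕ × ℕ) → Set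
IsLinearExtension n α T =
  (∀ x → 1 ≤ x → x ≤ n → InD α (T x)) ×
  (∀ x y → 1 ≤ x → x ≤ n → 1 ≤ y → y ≤ n → T x ≡ T y → x ≡ y) ×
  (∀ p → InD α p → ∃ λ x → 1 ≤ x × x ≤ n × T x ≡ p) ×
  (∀ x y → 1 ≤ x → x ≤ n → 1 ≤ y → y ≤ n → T x ≥D T y → y ≤ x)

InS′ : ℕ → List ℕ → Set
InS′ n π = (π ↭ upTo (suc n)) × ∃ λ ρ → π ≡ ρ ++ (0 ∷ [])

-- T⁻¹(p) (first x ∈ [n] with T x = p; unique when T is a bijection [n] → D(α))
Tinv : ℕ → (ℕ → ℕ × ℕ) → ℕ × ℕ → ℕ
Tinv n T (i , j) with firstJust (oneTo n)
  (λ x → if (proj₁ (T x) ≡ᵇ i) ∧ (proj₂ (T x) ≡ᵇ j) then just x else nothing)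
... | just (x , _) = x
... | nothing      = 0

-- T = T_π as functions on [n] (in particular D(α) = D(α_π), i.e. α = α_π)
TEqTπ : ℕ → List ℕ → (ℕ → ℕ × ℕ) → List ℕ → Set
TEqTπ n α T π = (∀ x → 1 ≤ x → x ≤ n → Tπ π x ≡ just (T x)) × απ n π ≡ α

CondA : ℕ → List ℕ → (ℕ → ℕ × ℕ) → List ℕ → Set
CondA n α T π = map (λ j → Tinv n T (1 , j)) (oneTo (length α)) ⊆ π

-- r = max { j' < j : α_{j'} ≥ i - 1 }, or 0
lastBelow : ℕ → (ℕ → Bool) → ℕ
lastBelow zero    p = 0
lastBelow (suc k) p = if p (suc k) then suc k else lastBelow k p

rIdx : List ℕ → ℕ → ℕ → ℕ
rIdx α i j = lastBelow (j Data.Nat.∸ 1) (λ j' → (i Data.Nat.∸ 1) ≤ᵇ at α j')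

Bblock : ℕ → List ℕ → (ℕ → ℕ × ℕ) → List ℕ → ℕ → ℕ → List ℕ
Bblock n α T π i j with rIdx α i j
... | zero  = throughIncl (Tinv n T (1 , j)) π
... | suc r = strictlyAfter (Tinv n T (1 , suc r)) (throughIncl (Tinv n T (1 , j)) π)

CondB : ℕ → List ℕ → (ℕ → ℕ × ℕ) → List ℕ → Set
CondB n α T π = ∀ i j → InD α (i , j) → 1 < i → Tinv n T (i , j) ∈ Bblock n α T π i j

module Submission where

open import Defs
open import Data.Bool using (Bool; true; false; if_then_else_; _∧_)
import Data.Bool as Bool
open import Data.Bool.Properties using (∧-zeroʳ)
open import Data.Empty using (⊥-elim)
open import Data.List using (List; []; _∷_; _++_; length; map; concat; foldr; applyUpTo; upTo; filterᵇ)
open import Data.List.Properties using (∷-injective; ++-assoc; ++-identityʳ; map-++; concat-++; length-map; length-upTo; length-++)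
open import Data.List.Membership.Propositional using (_∈_; _∉_)
open import Data.List.Membership.Propositional.Properties using (∈-++⁺ˡ; ∈-++⁺ʳ; ∈-++⁻; ∈-∃++; ∈-upTo⁺; ∈-upTo⁻; ∈-map⁻; ∈-map⁺; ∈-filter⁻; ∈-filter⁺)
open import Data.List.Relation.Unary.Any using (here; there)
open import Data.List.Relation.Unary.All using (All; []; _∷_)
import Data.List.Relation.Unary.All as All
open import Data.List.Relation.Unary.AllPairs using ([]; _∷_)
open import Data.List.Relation.Unary.Unique.Propositional using (Unique)
open import Data.List.Relation.Unary.Unique.Propositional.Properties using (Unique[x∷xs]⇒x∉xs; upTo⁺; filter⁺)
open import Data.List.Relation.Binary.Permutation.Propositional using (_↭_; ↭-refl; ↭-sym; ↭-trans; ↭-reflexive; prep; ↭⇒↭ₛ)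
open import Data.List.Relation.Binary.Permutation.Propositional.Properties using (shift; ∈-resp-↭; ↭-length)
open import Data.List.Relation.Binary.Permutation.Setoid.Properties using (Unique-resp-↭)
open import Data.List.Relation.Binary.Sublist.Propositional using (_⊆_; []; _∷ʳ_; _∷_)
open import Data.List.Relation.Binary.Sublist.Propositional.Properties using (++⁺ˡ; ++⁺ʳ)
open import Data.Maybe using (Maybe; just; nothing; _>>=_)
open import Data.Maybe.Properties using (just-injective)
open import Data.Nat
open import Data.Nat.ListAction using (sum)
open import Data.Nat.Properties
open import Data.List.Membership.DecPropositional _≟_ using (_∈?_)
open import Data.Product using (Σ; _×_; _,_; proj₁; proj₂)
open import Data.Sum using (_⊎_; inj₁; inj₂)
open import Function using (_∘_)
open import Function.Bundles using (_⇔_; mk⇔)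
open import Relation.Binary.Definitions using (tri<; tri≈; tri>)
open import Relation.Binary.PropositionalEquality
open import Relation.Binary.PropositionalEquality.Properties using (setoid)
open import Relation.Nullary using (yes; no)
open import Relation.Nullary.Decidable using (T?)

-- Write π = ρ ++ 0 ∷ [] and let left i be the part of s^{i-1}(π) before 0, so that
-- layer π i is the chain decomposition of left i.  Both directions follow one induction
-- on the column i, with the invariant that left i is the concatenation of blocks
-- blk j ++ T⁻¹(i,j) over the rows j with α_j ≥ i.  Once these blocks are decreasing,
-- chain recovers exactly the pairs (blk j , T⁻¹(i,j)), and the stack-sorting map acts
-- on left i block by block.  Sorting a block moves its maximum to its end; if that
-- maximum is T⁻¹(i+1,j), regrouping the sorted blocks at these maxima yields the blocks
-- of column i+1.
--
-- To control the blocks, every entry y remembers the segment seg y of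
-- ρ = B 1 ++ T⁻¹(1,1) ∷ B 2 ++ T⁻¹(1,2) ∷ … it comes from; condition (a) is exactly the
-- existence of this decomposition of ρ.  Condition (b) says that seg y lies between the
-- last row above row(y) reaching column col(y) − 1 and row(y) itself.  Given (a) and (b)
-- this makes every block decreasing with maximum T⁻¹(i+1,j), and every entry gets placed,
-- so T = T_π; conversely, if T = T_π the same invariant holds because the blocks are the
-- ones read off by T_π, and (b) can be read off from it.

≡true⇒T : ∀ {b} → b ≡ true → Bool.T b
≡true⇒T refl = _

<⇒<ᵇ≡true : ∀ {m n} → m < n → (m <ᵇ n) ≡ true
<⇒<ᵇ≡true {m} {n} m<n with m <ᵇ n | <⇒<ᵇ m<n
... | true | _ = refl

≤⇒<ᵇ≡false : ∀ {m n} → n ≤ m → (m <ᵇ n) ≡ false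
≤⇒<ᵇ≡false {m} {n} n≤m with m <ᵇ n in eq
... | false = refl
... | true = ⊥-elim (<⇒≱ (<ᵇ⇒< m n (≡true⇒T eq)) n≤m)

≤⇒≤ᵇ≡true : ∀ {m n} → m ≤ n → (m ≤ᵇ n) ≡ true
≤⇒≤ᵇ≡true {m} {n} m≤n with m ≤ᵇ n | ≤⇒≤ᵇ m≤n
... | true | _ = refl

≤ᵇ≡true⇒≤ : ∀ {m n} → (m ≤ᵇ n) ≡ true → m ≤ n
≤ᵇ≡true⇒≤ {m} {n} eq = ≤ᵇ⇒≤ m n (≡true⇒T eq)

>⇒≤ᵇ≡false : ∀ {m n} → n < m → (m ≤ᵇ n) ≡ false
>⇒≤ᵇ≡false {m} {n} n<m with m ≤ᵇ n in eq
... | false = refl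
... | true = ⊥-elim (<⇒≱ n<m (≤ᵇ≡true⇒≤ eq))

≡ᵇ-refl : ∀ m → (m ≡ᵇ m) ≡ true
≡ᵇ-refl m with m ≡ᵇ m | ≡⇒≡ᵇ m m refl
... | true | _ = refl

≡ᵇ≡true⇒≡ : ∀ {m n} → (m ≡ᵇ n) ≡ true → m ≡ n
≡ᵇ≡true⇒≡ {m} {n} eq = ≡ᵇ⇒≡ m n (≡true⇒T eq)

≢⇒≡ᵇ≡false : ∀ {m n} → m ≢ n → (m ≡ᵇ n) ≡ false
≢⇒≡ᵇ≡false {m} {n} m≢n with m ≡ᵇ n in eq
... | false = refl
... | true = ⊥-elim (m≢n (≡ᵇ≡true⇒≡ eq))

false≢true : false ≢ true
false≢true ()

empty-if-no-members : (E : List ℕ) → (∀ {y} → y ∉ E) → E ≡ []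
empty-if-no-members [] _ = refl
empty-if-no-members (e ∷ E) e∉E = ⊥-elim (e∉E (here refl))

Unique-++⁻ˡ : ∀ (A : List ℕ) {B} → Unique (A ++ B) → Unique A
Unique-++⁻ˡ [] u = []
Unique-++⁻ˡ (a ∷ A) (a∉ ∷ u) = All.tabulate (λ x∈ → All.lookup a∉ (∈-++⁺ˡ x∈)) ∷ Unique-++⁻ˡ A u

Unique-++⁻ʳ : ∀ (A : List ℕ) {B} → Unique (A ++ B) → Unique B
Unique-++⁻ʳ [] u = u
Unique-++⁻ʳ (a ∷ A) (_ ∷ u) = Unique-++⁻ʳ A u

Unique-++⇒disjoint : ∀ (A : List ℕ) {B x} → Unique (A ++ B) → x ∈ A → x ∉ B
Unique-++⇒disjoint (a ∷ A) (a∉ ∷ u) (here refl) x∈B = All.lookup a∉ (∈-++⁺ʳ A x∈B) refl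
Unique-++⇒disjoint (a ∷ A) (_ ∷ u) (there x∈A) x∈B = Unique-++⇒disjoint A u x∈A x∈B

Unique-middle⁻ : ∀ A {M} {B : List ℕ} → Unique (A ++ M ∷ B) → Unique B
Unique-middle⁻ A u with Unique-++⁻ʳ A u
... | _ ∷ uB = uB

Unique-middle∉ˡ : ∀ A {M} {B : List ℕ} → Unique (A ++ M ∷ B) → M ∉ A
Unique-middle∉ˡ A u M∈A = Unique-++⇒disjoint A u M∈A (here refl)

Unique-middle∉ʳ : ∀ A {M} {B : List ℕ} → Unique (A ++ M ∷ B) → M ∉ B
Unique-middle∉ʳ A u = Unique[x∷xs]⇒x∉xs (Unique-++⁻ʳ A u)

split-at-member : ∀ {l : List ℕ} {y} → Unique l → y ∈ l →
  Σ (List ℕ) λ A → Σ (List ℕ) λ B → l ≡ A ++ y ∷ B × y ∉ A × y ∉ B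
split-at-member u y∈ with ∈-∃++ y∈
... | A , B , refl = A , B , refl , Unique-middle∉ˡ A u , Unique-middle∉ʳ A u

Unique-map⁺ : ∀ (f : ℕ → ℕ) l → Unique l → (∀ {x y} → x ∈ l → y ∈ l → f x ≡ f y → x ≡ y) → Unique (map f l)
Unique-map⁺ f [] _ _ = []
Unique-map⁺ f (x ∷ l) (x∉ ∷ u) inj = All.tabulate fx∉ ∷ Unique-map⁺ f l u (λ x∈ y∈ → inj (there x∈) (there y∈))
  where
  fx∉ : ∀ {z} → z ∈ map f l → f x ≢ z
  fx∉ z∈ fx≡z with ∈-map⁻ f z∈
  ... | y , y∈ , refl = All.lookup x∉ y∈ (inj (here refl) (there y∈) fx≡z)

remove-member : ∀ {x} (ys : List ℕ) → x ∈ ys →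
  Σ (List ℕ) λ zs → length ys ≡ suc (length zs) × (∀ {y} → y ∈ ys → y ≢ x → y ∈ zs)
remove-member ys x∈ with ∈-∃++ x∈
... | P , Q , refl = P ++ Q , length-eq , keep
  where
  length-eq : length (P ++ _ ∷ Q) ≡ suc (length (P ++ Q))
  length-eq = trans (length-++ P) (trans (+-suc (length P) (length Q)) (cong suc (sym (length-++ P))))
  keep : ∀ {y} → y ∈ P ++ _ ∷ Q → y ≢ _ → y ∈ P ++ Q
  keep y∈ y≢x with ∈-++⁻ P y∈
  ... | inj₁ y∈P = ∈-++⁺ˡ y∈P
  ... | inj₂ (here refl) = ⊥-elim (y≢x refl)
  ... | inj₂ (there y∈Q) = ∈-++⁺ʳ P y∈Q

Unique-length-≤ : ∀ (xs ys : List ℕ) → Unique xs → (∀ {x} → x ∈ xs → x ∈ ys) → length xs ≤ length ys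
Unique-length-≤ [] ys _ _ = z≤n
Unique-length-≤ (x ∷ xs) ys (x∉ ∷ u) xs⊆ys with remove-member ys (xs⊆ys (here refl))
... | zs , len , keep = subst (suc (length xs) ≤_) (sym len)
    (s≤s (Unique-length-≤ xs zs u (λ y∈ → keep (xs⊆ys (there y∈)) (λ y≡x → All.lookup x∉ y∈ (sym y≡x)))))

Unique-length-≡ : ∀ (xs ys : List ℕ) → Unique xs → Unique ys →
  (∀ {x} → x ∈ xs → x ∈ ys) → (∀ {x} → x ∈ ys → x ∈ xs) → length xs ≡ length ys
Unique-length-≡ xs ys uxs uys xs⊆ys ys⊆xs = ≤-antisym (Unique-length-≤ xs ys uxs xs⊆ys) (Unique-length-≤ ys xs uys ys⊆xs)

cut-++ : ∀ y A B → y ∉ A → cut y (A ++ y ∷ B) ≡ (A , B)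
cut-++ y [] B _ rewrite ≡ᵇ-refl y = refl
cut-++ y (a ∷ A) B y∉ rewrite ≢⇒≡ᵇ≡false {a} {y} (λ e → y∉ (here (sym e))) | cut-++ y A B (y∉ ∘ there) = refl

cut-++-unique : ∀ {M} A B A′ B′ → M ∉ A → M ∉ A′ → A ++ M ∷ B ≡ A′ ++ M ∷ B′ → A ≡ A′ × B ≡ B′
cut-++-unique {M} A B A′ B′ M∉A M∉A′ eq
  with trans (sym (cut-++ M A B M∉A)) (trans (cong (cut M) eq) (cut-++ M A′ B′ M∉A′))
... | refl = refl , refl

cut-after-skip : ∀ y P c Q → y ∉ P → y ≢ c → proj₂ (cut y (P ++ c ∷ Q)) ≡ proj₂ (cut y Q)
cut-after-skip y [] c Q _ y≢c rewrite ≢⇒≡ᵇ≡false {c} {y} (λ e → y≢c (sym e)) = refl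
cut-after-skip y (a ∷ P) c Q y∉ y≢c rewrite ≢⇒≡ᵇ≡false {a} {y} (λ e → y∉ (here (sym e))) =
  cut-after-skip y P c Q (y∉ ∘ there) y≢c

cut-after-⊆ : ∀ y l {x} → x ∈ proj₂ (cut y l) → x ∈ l
cut-after-⊆ y (a ∷ l) x∈ with a ≡ᵇ y
... | true = there x∈
... | false = there (cut-after-⊆ y l x∈)

length-cut-before : ∀ y l → length (proj₁ (cut y l)) ≤ length l
length-cut-before y [] = z≤n
length-cut-before y (a ∷ l) with a ≡ᵇ y
... | true = z≤n
... | false = s≤s (length-cut-before y l)

throughIncl-++ : ∀ y A B → y ∉ A → throughIncl y (A ++ y ∷ B) ≡ A ++ y ∷ []
throughIncl-++ y [] B _ rewrite ≡ᵇ-refl y = refl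
throughIncl-++ y (a ∷ A) B y∉ rewrite ≢⇒≡ᵇ≡false {a} {y} (λ e → y∉ (here (sym e))) =
  cong (a ∷_) (throughIncl-++ y A B (y∉ ∘ there))

throughIncl-⊆-prefix : ∀ {d y} (X W : List ℕ) → d ∈ X → y ∈ throughIncl d (X ++ W) → y ∈ X
throughIncl-⊆-prefix {d} (x ∷ X) W d∈ y∈ with x ≡ᵇ d in eq
... | true with y∈
...   | here refl = here refl
throughIncl-⊆-prefix {d} (x ∷ X) W d∈ y∈ | false with y∈ | d∈
... | here refl | _ = here refl
... | there y∈′ | here refl = ⊥-elim (false≢true (trans (sym eq) (≡ᵇ-refl x)))
... | there y∈′ | there d∈′ = there (throughIncl-⊆-prefix X W d∈′ y∈′)

strictlyAfter-++ : ∀ y A B → y ∉ A → strictlyAfter y (A ++ y ∷ B) ≡ B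
strictlyAfter-++ y [] B _ rewrite ≡ᵇ-refl y = refl
strictlyAfter-++ y (a ∷ A) B y∉ rewrite ≢⇒≡ᵇ≡false {a} {y} (λ e → y∉ (here (sym e))) =
  strictlyAfter-++ y A B (y∉ ∘ there)

strictlyAfter-⊆ : ∀ d (l : List ℕ) {y} → y ∈ strictlyAfter d l → y ∈ l
strictlyAfter-⊆ d (x ∷ l) y∈ with x ≡ᵇ d
... | true = there y∈
... | false = there (strictlyAfter-⊆ d l y∈)

max-≤ : ∀ {M} x xs → All (_≤ M) (x ∷ xs) → foldr _⊔_ x xs ≤ M
max-≤ x [] (x≤M ∷ _) = x≤M
max-≤ x (y ∷ ys) (x≤M ∷ y≤M ∷ ys≤M) = ⊔-lub y≤M (max-≤ x ys (x≤M ∷ ys≤M))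

≤-max : ∀ {e} x xs → e ∈ x ∷ xs → e ≤ foldr _⊔_ x xs
≤-max x [] (here refl) = ≤-refl
≤-max x (y ∷ ys) (here refl) = ≤-trans (≤-max x ys (here refl)) (m≤n⊔m y _)
≤-max x (y ∷ ys) (there (here refl)) = m≤m⊔n y _
≤-max x (y ∷ ys) (there (there e∈)) = ≤-trans (≤-max x ys (there e∈)) (m≤n⊔m y _)

max-∈ : ∀ x xs → foldr _⊔_ x xs ∈ x ∷ xs
max-∈ x [] = here refl
max-∈ x (y ∷ ys) with ⊔-sel y (foldr _⊔_ x ys)
... | inj₁ e = there (here e)
... | inj₂ e with max-∈ x ys
...   | here e′ = here (trans e e′)
...   | there e′ = there (there (subst (_∈ ys) (sym e) e′))

max-greatest : ∀ x xs → All (_≤ foldr _⊔_ x xs) (x ∷ xs)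
max-greatest x xs = All.tabulate (≤-max x xs)

max-≡ : ∀ {M} x xs → M ∈ x ∷ xs → All (_≤ M) (x ∷ xs) → foldr _⊔_ x xs ≡ M
max-≡ x xs M∈ le = ≤-antisym (max-≤ x xs le) (≤-max x xs M∈)

a<a+suc : ∀ a k → a < a + suc k
a<a+suc a k = subst (a <_) (sym (+-suc a k)) (s≤s (m≤m+n a k))

range : ℕ → ℕ → List ℕ
range a zero = []
range a (suc k) = a ∷ range (suc a) k

oneTo≡range : ∀ k → oneTo k ≡ range 1 k
oneTo≡range k = go suc (λ i → i) k (λ i → refl)
  where
  go : ∀ {a} (g f : ℕ → ℕ) k → (∀ i → g (f i) ≡ a + i) → map g (applyUpTo f k) ≡ range a k
  go g f zero _ = refl
  go {a} g f (suc k) g∘f≡ =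
    cong₂ _∷_ (trans (g∘f≡ 0) (+-identityʳ a)) (go g (f ∘ suc) k (λ i → trans (g∘f≡ (suc i)) (+-suc a i)))

lower-bound-range : ∀ {a k x} → x ∈ range a k → a ≤ x
lower-bound-range {a} {suc k} (here refl) = ≤-refl
lower-bound-range {a} {suc k} (there x∈) = <⇒≤ (lower-bound-range x∈)

upper-bound-range : ∀ {a k x} → x ∈ range a k → x < a + k
upper-bound-range {a} {suc k} (here refl) = a<a+suc a k
upper-bound-range {a} {suc k} {x} (there x∈) = subst (x <_) (sym (+-suc a k)) (upper-bound-range x∈)

∈-range : ∀ {a k x} → a ≤ x → x < a + k → x ∈ range a k
∈-range {a} {zero} {x} lo hi = ⊥-elim (<⇒≱ hi (subst (_≤ x) (sym (+-identityʳ a)) lo))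
∈-range {a} {suc k} {x} lo hi with m≤n⇒m<n∨m≡n lo
... | inj₂ refl = here refl
... | inj₁ a<x = there (∈-range a<x (subst (x <_) (+-suc a k) hi))

Unique-range : ∀ a k → Unique (range a k)
Unique-range a zero = []
Unique-range a (suc k) = All.tabulate (λ x∈ a≡x → <-irrefl a≡x (lower-bound-range x∈)) ∷ Unique-range (suc a) k

range-++ : ∀ a k₁ k₂ → range a (k₁ + k₂) ≡ range a k₁ ++ range (a + k₁) k₂
range-++ a zero k₂ = cong (λ b → range b k₂) (sym (+-identityʳ a))
range-++ a (suc k₁) k₂ =
  cong (a ∷_) (trans (range-++ (suc a) k₁ k₂) (cong (λ b → range (suc a) k₁ ++ range b k₂) (sym (+-suc a k₁))))

length-range : ∀ a k → length (range a k) ≡ k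
length-range a zero = refl
length-range a (suc k) = cong suc (length-range (suc a) k)

map-cong-∈ : ∀ {A B : Set} (f g : A → B) (l : List A) → (∀ {x} → x ∈ l → f x ≡ g x) → map f l ≡ map g l
map-cong-∈ f g [] _ = refl
map-cong-∈ f g (x ∷ l) f≡g = cong₂ _∷_ (f≡g (here refl)) (map-cong-∈ f g l (f≡g ∘ there))

∈-concat-range⁻ : ∀ (F : ℕ → List ℕ) a k {y} → y ∈ concat (map F (range a k)) →
  Σ ℕ λ t → a ≤ t × t < a + k × y ∈ F t
∈-concat-range⁻ F a (suc k) y∈ with ∈-++⁻ (F a) y∈
... | inj₁ y∈Fa = a , ≤-refl , a<a+suc a k , y∈Fa
... | inj₂ y∈rest with ∈-concat-range⁻ F (suc a) k y∈rest
...   | t , lo , hi , y∈Ft = t , <⇒≤ lo , subst (t <_) (sym (+-suc a k)) hi , y∈Ft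

∈-concat-range⁺ : ∀ (F : ℕ → List ℕ) a k {y t} → a ≤ t → t < a + k → y ∈ F t → y ∈ concat (map F (range a k))
∈-concat-range⁺ F a zero lo hi _ = ⊥-elim (<⇒≱ hi (subst (_≤ _) (sym (+-identityʳ a)) lo))
∈-concat-range⁺ F a (suc k) {t = t} lo hi y∈ with m≤n⇒m<n∨m≡n lo
... | inj₂ refl = ∈-++⁺ˡ y∈
... | inj₁ a<t = ∈-++⁺ʳ (F a) (∈-concat-range⁺ F (suc a) k a<t (subst (t <_) (+-suc a k) hi) y∈)

Unique-concat-range⇒index-unique : ∀ (F : ℕ → List ℕ) a k {y t t′} → Unique (concat (map F (range a k))) →
  a ≤ t → t < a + k → a ≤ t′ → t′ < a + k → y ∈ F t → y ∈ F t′ → t ≡ t′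
Unique-concat-range⇒index-unique F a zero u lo hi _ _ _ _ = ⊥-elim (<⇒≱ hi (subst (_≤ _) (sym (+-identityʳ a)) lo))
Unique-concat-range⇒index-unique F a (suc k) {t = t} {t′} u lo hi lo′ hi′ y∈ y∈′
  with m≤n⇒m<n∨m≡n lo | m≤n⇒m<n∨m≡n lo′
... | inj₂ refl | inj₂ refl = refl
... | inj₂ refl | inj₁ a<t′ =
  ⊥-elim (Unique-++⇒disjoint (F a) u y∈ (∈-concat-range⁺ F (suc a) k a<t′ (subst (t′ <_) (+-suc a k) hi′) y∈′))
... | inj₁ a<t | inj₂ refl =
  ⊥-elim (Unique-++⇒disjoint (F a) u y∈′ (∈-concat-range⁺ F (suc a) k a<t (subst (t <_) (+-suc a k) hi) y∈))
... | inj₁ a<t | inj₁ a<t′ =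
  Unique-concat-range⇒index-unique F (suc a) k (Unique-++⁻ʳ (F a) u)
    a<t (subst (t <_) (+-suc a k) hi) a<t′ (subst (t′ <_) (+-suc a k) hi′) y∈ y∈′

Unique-concat-range⁻ : ∀ (F : ℕ → List ℕ) a k {t} → Unique (concat (map F (range a k))) →
  a ≤ t → t < a + k → Unique (F t)
Unique-concat-range⁻ F a zero u lo hi = ⊥-elim (<⇒≱ hi (subst (_≤ _) (sym (+-identityʳ a)) lo))
Unique-concat-range⁻ F a (suc k) {t} u lo hi with m≤n⇒m<n∨m≡n lo
... | inj₂ refl = Unique-++⁻ˡ (F a) u
... | inj₁ a<t = Unique-concat-range⁻ F (suc a) k (Unique-++⁻ʳ (F a) u) a<t (subst (t <_) (+-suc a k) hi)

firstJust-sound : ∀ {A : Set} l (f : ℕ → Maybe A) {k v} → firstJust l f ≡ just (k , v) → k ∈ l × f k ≡ just v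
firstJust-sound (i ∷ l) f eq with f i in fi
... | just a with eq
...   | refl = here refl , fi
firstJust-sound (i ∷ l) f eq | nothing with firstJust-sound l f eq
...   | k∈ , fk = there k∈ , fk

firstJust-unique : ∀ {A : Set} l (f : ℕ → Maybe A) {k v} → k ∈ l → f k ≡ just v →
  (∀ i → i ∈ l → i ≢ k → f i ≡ nothing) → firstJust l f ≡ just (k , v)
firstJust-unique (i ∷ l) f (here refl) fk _ rewrite fk = refl
firstJust-unique (i ∷ l) f {k} (there k∈) fk others with f i in fi
... | nothing = firstJust-unique l f k∈ fk (λ i′ i∈ → others i′ (there i∈))
... | just a with i ≟ k
...   | yes refl rewrite fk with fi
...     | refl = refl
firstJust-unique (i ∷ l) f {k} (there k∈) fk others | just a | no i≢k with trans (sym fi) (others i (here refl) i≢k)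
... | ()

firstJust-least : ∀ {A : Set} a N (f : ℕ → Maybe A) {k v i w} → firstJust (range a N) f ≡ just (k , v) →
  a ≤ i → f i ≡ just w → k ≤ i
firstJust-least a (suc N) f {i = i} eq lo fi with f a in fa
... | just b with eq
...   | refl = lo
firstJust-least a (suc N) f {i = i} eq lo fi | nothing with m≤n⇒m<n∨m≡n lo
... | inj₁ a<i = firstJust-least (suc a) N f eq a<i fi
... | inj₂ refl with trans (sym fa) fi
... | ()

posIn-∉ : ∀ x P → x ∉ map proj₂ P → posIn x P ≡ nothing
posIn-∉ x [] _ = refl
posIn-∉ x ((b , c) ∷ r) x∉ rewrite ≢⇒≡ᵇ≡false {c} {x} (λ e → x∉ (here (sym e))) | posIn-∉ x r (x∉ ∘ there) = refl

posIn-∈ : ∀ x P → x ∈ map proj₂ P → Σ ℕ λ k → posIn x P ≡ just k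
posIn-∈ x ((b , c) ∷ r) x∈ with c ≡ᵇ x in eq
... | true = 1 , refl
posIn-∈ x ((b , c) ∷ r) (here refl) | false = ⊥-elim (false≢true (trans (sym eq) (≡ᵇ-refl c)))
posIn-∈ x ((b , c) ∷ r) (there x∈) | false with posIn-∈ x r x∈
... | k , eq′ rewrite eq′ = suc k , refl

posIn-sound : ∀ x P {k} → posIn x P ≡ just k → x ∈ map proj₂ P
posIn-sound x ((b , c) ∷ r) eq with c ≡ᵇ x in c≡x
... | true = here (sym (≡ᵇ≡true⇒≡ c≡x))
... | false with posIn x r in eq′
...   | just k′ = there (posIn-sound x r eq′)
posIn-sound x ((b , c) ∷ r) () | false | nothing

posIn-positive : ∀ x P {k} → posIn x P ≡ just k → 1 ≤ k
posIn-positive x ((b , c) ∷ r) eq with c ≡ᵇ x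
... | true = subst (1 ≤_) (just-injective eq) ≤-refl
... | false with posIn x r
...   | just k′ = subst (1 ≤_) (just-injective eq) (s≤s z≤n)
posIn-positive x ((b , c) ∷ r) () | false | nothing

owner-sound : ∀ x P {c} → owner x P ≡ just c →
  Σ (List ℕ) λ b → (b , c) ∈ P × Σ ℕ λ y → Σ (List ℕ) λ ys → b ≡ y ∷ ys × foldr _⊔_ y ys ≡ x
owner-sound x (([] , c′) ∷ r) eq with owner-sound x r eq
... | b , b∈ , rest = b , there b∈ , rest
owner-sound x ((y ∷ ys , c′) ∷ r) eq with foldr _⊔_ y ys ≡ᵇ x in max≡x
... | true with eq
...   | refl = y ∷ ys , here refl , y , ys , refl , ≡ᵇ≡true⇒≡ max≡x
owner-sound x ((y ∷ ys , c′) ∷ r) eq | false with owner-sound x r eq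
...   | b , b∈ , rest = b , there b∈ , rest

owner-complete : ∀ x P {c y ys} → (y ∷ ys , c) ∈ P → foldr _⊔_ y ys ≡ x →
  (∀ {b′ c′} → (b′ , c′) ∈ P → x ∈ b′ → c′ ≡ c) → owner x P ≡ just c
owner-complete x (([] , c′) ∷ r) (there e∈) max≡x only = owner-complete x r e∈ max≡x (only ∘ there)
owner-complete x ((z ∷ zs , c′) ∷ r) e∈ max≡x only with foldr _⊔_ z zs ≡ᵇ x in eq
... | true = cong just (only (here refl) (subst (_∈ z ∷ zs) (≡ᵇ≡true⇒≡ eq) (max-∈ z zs)))
owner-complete x ((z ∷ zs , c′) ∷ r) (here refl) max≡x only | false =
  ⊥-elim (false≢true (trans (sym eq) (subst (λ q → (q ≡ᵇ x) ≡ true) (sym max≡x) (≡ᵇ-refl x))))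
owner-complete x ((z ∷ zs , c′) ∷ r) (there e∈) max≡x only | false = owner-complete x r e∈ max≡x (only ∘ there)

scAux-≥ : ∀ k f σ → k ≤ f → (∀ k′ → k′ < k → increasing (iter k′ σ) ≡ false) → k ≤ scAux f σ
scAux-≥ zero f σ _ _ = z≤n
scAux-≥ (suc k) (suc f) σ (s≤s k≤f) notInc rewrite notInc 0 (s≤s z≤n) =
  s≤s (scAux-≥ k f (s σ) k≤f (λ k′ lt → notInc (suc k′) (s≤s lt)))

count≡length-filterᵇ : ∀ p l → count p l ≡ length (filterᵇ p l)
count≡length-filterᵇ p [] = refl
count≡length-filterᵇ p (x ∷ l) with p x
... | true = cong suc (count≡length-filterᵇ p l)
... | false = count≡length-filterᵇ p l

count-cong : ∀ (p q : ℕ → Bool) l → (∀ {x} → x ∈ l → p x ≡ q x) → count p l ≡ count q l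
count-cong p q [] _ = refl
count-cong p q (x ∷ l) p≡q rewrite p≡q (here refl) with q x
... | true = cong suc (count-cong p q l (p≡q ∘ there))
... | false = count-cong p q l (p≡q ∘ there)

sublist-split : ∀ {x xs} (ys : List ℕ) → (x ∷ xs) ⊆ ys →
  Σ (List ℕ) λ P → Σ (List ℕ) λ Q → ys ≡ P ++ x ∷ Q × xs ⊆ Q
sublist-split (y ∷ ys) (.y ∷ʳ sub) with sublist-split ys sub
... | P , Q , refl , sub′ = y ∷ P , Q , refl , sub′
sublist-split (y ∷ ys) (refl ∷ sub) = [] , ys , refl , sub

sublist-drop-last : ∀ {xs} (ys : List ℕ) {z} → xs ⊆ ys ++ z ∷ [] → z ∉ xs → xs ⊆ ys
sublist-drop-last [] (_ ∷ʳ []) _ = []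
sublist-drop-last [] (refl ∷ _) z∉ = ⊥-elim (z∉ (here refl))
sublist-drop-last (y ∷ ys) (.y ∷ʳ sub) z∉ = y ∷ʳ sublist-drop-last ys sub z∉
sublist-drop-last (y ∷ ys) (e ∷ sub) z∉ = e ∷ sublist-drop-last ys sub (z∉ ∘ there)

∸-suc : ∀ j a → a < j → j ∸ a ≡ suc (j ∸ suc a)
∸-suc (suc j) zero _ = refl
∸-suc (suc j) (suc a) (s≤s a<j) = ∸-suc j a a<j

posIn-map-range : ∀ (d : ℕ → ℕ) (blk : ℕ → List ℕ) a k j → (∀ t → a ≤ t → t < a + k → d t ≡ d j → t ≡ j) →
  a ≤ j → j < a + k → posIn (d j) (map (λ t → (blk t , d t)) (range a k)) ≡ just (suc (j ∸ a))
posIn-map-range d blk a zero j _ lo hi = ⊥-elim (<⇒≱ hi (subst (_≤ _) (sym (+-identityʳ a)) lo))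
posIn-map-range d blk a (suc k) j inj lo hi with m≤n⇒m<n∨m≡n lo
... | inj₂ refl rewrite ≡ᵇ-refl (d a) | n∸n≡0 a = refl
... | inj₁ a<j
  rewrite ≢⇒≡ᵇ≡false {d a} {d j} (λ e → <-irrefl (inj a ≤-refl (a<a+suc a k) e) a<j)
        | posIn-map-range d blk (suc a) k j (λ t lo′ hi′ → inj t (<⇒≤ lo′) (subst (t <_) (sym (+-suc a k)) hi′))
            a<j (subst (j <_) (+-suc a k) hi)
  = cong (just ∘ suc) (sym (∸-suc j a a<j))

keys-from-posIn : ∀ (d : ℕ → ℕ) Q a k → length Q ≡ k →
  (∀ j → a ≤ j → j < a + k → posIn (d j) Q ≡ just (suc (j ∸ a))) → map proj₂ Q ≡ map d (range a k)
keys-from-posIn d [] a zero _ _ = refl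
keys-from-posIn d ((b , c) ∷ Q) a (suc k) refl pos = cong₂ _∷_ head≡ (keys-from-posIn d Q (suc a) k refl pos′)
  where
  head≡ : c ≡ d a
  head≡ with c ≡ᵇ d a in eq | pos a ≤-refl (a<a+suc a k)
  ... | true | _ = ≡ᵇ≡true⇒≡ eq
  ... | false | e with posIn (d a) Q in eq′ | e
  ...   | just k′ | e′ = ⊥-elim (<⇒≱ (posIn-positive (d a) Q eq′) (≤-reflexive (trans (suc-injective (just-injective e′)) (n∸n≡0 a))))
  ...   | nothing | ()
  pos′ : ∀ j → suc a ≤ j → j < suc a + k → posIn (d j) Q ≡ just (suc (j ∸ suc a))
  pos′ j lo hi with c ≡ᵇ d j | pos j (<⇒≤ lo) (subst (j <_) (sym (+-suc a k)) hi)
  ... | true | e = ⊥-elim (0≢1+n (suc-injective (trans (just-injective e) (cong suc (∸-suc j a lo)))))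
  ... | false | e with posIn (d j) Q | e
  ...   | just k′ | e′ = cong just (trans (suc-injective (just-injective e′)) (∸-suc j a lo))
  ...   | nothing | ()

update : (ℕ → List ℕ) → ℕ → List ℕ → ℕ → List ℕ
update f a v j = if j ≡ᵇ a then v else f j

update-same : ∀ f a v → update f a v a ≡ v
update-same f a v rewrite ≡ᵇ-refl a = refl

update-other : ∀ f a v j → a < j → update f a v j ≡ f j
update-other f a v j a<j rewrite ≢⇒≡ᵇ≡false {j} {a} (λ e → <-irrefl (sym e) a<j) = refl

blocksFrom : List (List ℕ × ℕ) → ℕ → ℕ → List ℕ
blocksFrom [] a j = []
blocksFrom ((b , c) ∷ r) a = update (blocksFrom r (suc a)) a b

tabulate-by-keys : ∀ (d : ℕ → ℕ) Q a k → map proj₂ Q ≡ map d (range a k) →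
  Q ≡ map (λ j → (blocksFrom Q a j , d j)) (range a k)
tabulate-by-keys d [] a zero _ = refl
tabulate-by-keys d ((b , c) ∷ Q) a (suc k) eq with ∷-injective eq
... | refl , eq′ = cong₂ _∷_ (cong (_, d a) (sym (update-same (blocksFrom Q (suc a)) a b)))
  (trans (tabulate-by-keys d Q (suc a) k eq′)
         (map-cong-∈ _ _ (range (suc a) k) λ {j} j∈ →
            cong (_, d j) (sym (update-other (blocksFrom Q (suc a)) a b j (lower-bound-range j∈)))))

sublist-range-decompose : ∀ (d : ℕ → ℕ) a k ys → map d (range a k) ⊆ ys →
  Σ (ℕ → List ℕ) λ blk → Σ (List ℕ) λ E → ys ≡ concat (map (λ j → blk j ++ d j ∷ []) (range a k)) ++ E
sublist-range-decompose d a zero ys _ = (λ _ → []) , ys , refl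
sublist-range-decompose d a (suc k) ys sub with sublist-split ys sub
... | P , Q , refl , sub′ with sublist-range-decompose d (suc a) k Q sub′
... | blk , E , Q≡ = blk′ , E , (begin
     P ++ d a ∷ Q
       ≡⟨ cong (λ z → P ++ d a ∷ z) Q≡ ⟩
     P ++ d a ∷ (concat (map (λ j → blk j ++ d j ∷ []) (range (suc a) k)) ++ E)
       ≡⟨ cong₂ (λ u v → u ++ d a ∷ (concat v ++ E)) (sym (update-same blk a P))
            (map-cong-∈ _ _ (range (suc a) k)
              (λ {j} j∈ → cong (_++ d j ∷ []) (sym (update-other blk a P j (lower-bound-range j∈))))) ⟩
     blk′ a ++ d a ∷ (rest ++ E)
       ≡⟨ sym (++-assoc (blk′ a) (d a ∷ []) (rest ++ E)) ⟩
     (blk′ a ++ d a ∷ []) ++ rest ++ E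
       ≡⟨ sym (++-assoc (blk′ a ++ d a ∷ []) rest E) ⟩
     ((blk′ a ++ d a ∷ []) ++ rest) ++ E ∎)
  where
  open ≡-Reasoning
  blk′ = update blk a P
  rest = concat (map (λ j → blk′ j ++ d j ∷ []) (range (suc a) k))

map-at-range : ∀ (γ : List ℕ) → map (at γ) (range 1 (length γ)) ≡ γ
map-at-range [] = refl
map-at-range (b ∷ γ) = cong (b ∷_) (trans (drop-head 0 (length γ)) (map-at-range γ))
  where
  drop-head : ∀ a l → map (at (b ∷ γ)) (range (suc (suc a)) l) ≡ map (at γ) (range (suc a) l)
  drop-head a zero = refl
  drop-head a (suc l) = cong (at γ (suc a) ∷_) (drop-head (suc a) l)

at-positive : ∀ (β : List ℕ) j → 1 ≤ j → j ≤ length β → All (1 ≤_) β → 1 ≤ at β j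
at-positive (b ∷ β) (suc zero) _ _ (1≤b ∷ _) = 1≤b
at-positive (b ∷ β) (suc (suc j)) _ (s≤s hi) (_ ∷ pos) = at-positive β (suc j) (s≤s z≤n) hi pos

at-≤-sum : ∀ (β : List ℕ) j → at β j ≤ sum β
at-≤-sum [] j = z≤n
at-≤-sum (b ∷ β) zero = z≤n
at-≤-sum (b ∷ β) (suc zero) = m≤m+n b (sum β)
at-≤-sum (b ∷ β) (suc (suc j)) = ≤-trans (at-≤-sum β (suc j)) (m≤n+m (sum β) b)

lastBelow-≤ : ∀ k p → lastBelow k p ≤ k
lastBelow-≤ zero p = z≤n
lastBelow-≤ (suc k) p with p (suc k)
... | true = ≤-refl
... | false = m≤n⇒m≤1+n (lastBelow-≤ k p)

≤-lastBelow : ∀ k p j → 1 ≤ j → j ≤ k → p j ≡ true → j ≤ lastBelow k p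
≤-lastBelow zero p j lo hi _ = ⊥-elim (<⇒≱ lo hi)
≤-lastBelow (suc k) p j lo hi pj with p (suc k) in p[k+1]
... | true = hi
... | false with m≤n⇒m<n∨m≡n hi
...   | inj₁ j<k+1 = ≤-lastBelow k p j lo (≤-pred j<k+1) pj
...   | inj₂ refl = ⊥-elim (false≢true (trans (sym p[k+1]) pj))

lastBelow-holds : ∀ k p r → lastBelow k p ≡ suc r → p (suc r) ≡ true
lastBelow-holds (suc k) p r eq with p (suc k) in p[k+1]
... | true with eq
...   | refl = p[k+1]
lastBelow-holds (suc k) p r eq | false = lastBelow-holds k p r eq

max-of-list : ∀ {x} (l : List ℕ) → x ∈ l → All (_≤ x) l → Σ ℕ λ y → Σ (List ℕ) λ ys → l ≡ y ∷ ys × foldr _⊔_ y ys ≡ x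
max-of-list (y ∷ ys) x∈ ≤x = y , ys , refl , max-≡ y ys x∈ ≤x

Tπ-just⁻ : ∀ π x {u v} → Tπ π x ≡ just (u , v) → Σ ℕ λ p → coord π x ≡ just (u , p) × rowAux π u x ≡ just v
Tπ-just⁻ π x eq with coord π x
Tπ-just⁻ π x () | nothing
... | just (u , p) with rowAux π u x in r≡
Tπ-just⁻ π x () | just (u , p) | nothing
Tπ-just⁻ π x refl | just (u , p) | just r = p , refl , r≡

Bblock⊆throughIncl : ∀ n α T π i j {y} → y ∈ Bblock n α T π i j → y ∈ throughIncl (Tinv n T (1 , j)) π
Bblock⊆throughIncl n α T π i j y∈ with rIdx α i j
... | zero = y∈
... | suc r = strictlyAfter-⊆ _ _ y∈

mutual
  stackRun-↭ : ∀ xs st → stackRun xs st ↭ xs ++ st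
  stackRun-↭ [] st = ↭-refl
  stackRun-↭ (x ∷ xs) st = stackRun-∷-↭ x xs st

  stackRun-∷-↭ : ∀ x xs st → stackRun (x ∷ xs) st ↭ x ∷ xs ++ st
  stackRun-∷-↭ x xs [] = ↭-trans (stackRun-↭ xs (x ∷ [])) (shift x xs [])
  stackRun-∷-↭ x xs (t ∷ st) with x <ᵇ t
  ... | true = ↭-trans (stackRun-↭ xs (x ∷ t ∷ st)) (shift x xs (t ∷ st))
  ... | false = ↭-trans (prep t (stackRun-∷-↭ x xs st)) (↭-sym (shift t (x ∷ xs) st))

s-↭ : ∀ σ → s σ ↭ σ
s-↭ σ = ↭-trans (stackRun-↭ σ []) (↭-reflexive (++-identityʳ σ))

iter-suc : ∀ k σ → iter (suc k) σ ≡ s (iter k σ)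
iter-suc zero σ = refl
iter-suc (suc k) σ = iter-suc k (s σ)

iter-↭ : ∀ k σ → iter k σ ↭ σ
iter-↭ zero σ = ↭-refl
iter-↭ (suc k) σ = ↭-trans (iter-↭ k (s σ)) (s-↭ σ)

stackRun-flush : ∀ {c} u st rest → All (_< c) u → All (c <_) st →
  stackRun (c ∷ rest) (u ++ st) ≡ stackRun [] u ++ stackRun rest (c ∷ st)
stackRun-flush [] [] rest _ _ = refl
stackRun-flush [] (t ∷ st) rest _ (c<t ∷ _) rewrite <⇒<ᵇ≡true c<t = refl
stackRun-flush {c} (t ∷ u) st rest (t<c ∷ u<c) c<st rewrite ≤⇒<ᵇ≡false {c} {t} (<⇒≤ t<c) =
  cong (t ∷_) (stackRun-flush u st rest u<c c<st)

-- An entry c above all entries read so far and below the rest of the stack empties the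
-- stack down to that rest: the output splits at c.
mutual
  stackRun-split : ∀ {c} S u st rest → All (_< c) S → All (_< c) u → All (c <_) st →
    stackRun (S ++ c ∷ rest) (u ++ st) ≡ stackRun S u ++ stackRun rest (c ∷ st)
  stackRun-split [] u st rest _ u<c c<st = stackRun-flush u st rest u<c c<st
  stackRun-split (x ∷ S) u st rest (x<c ∷ S<c) u<c c<st = stackRun-split-∷ x S u st rest x<c S<c u<c c<st

  stackRun-split-∷ : ∀ {c} x S u st rest → x < c → All (_< c) S → All (_< c) u → All (c <_) st →
    stackRun (x ∷ S ++ c ∷ rest) (u ++ st) ≡ stackRun (x ∷ S) u ++ stackRun rest (c ∷ st)
  stackRun-split-∷ x S [] [] rest x<c S<c _ _ = stackRun-split S (x ∷ []) [] rest S<c (x<c ∷ []) []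
  stackRun-split-∷ x S [] (t ∷ st) rest x<c S<c _ (c<t ∷ c<st) rewrite <⇒<ᵇ≡true (<-trans x<c c<t) =
    stackRun-split S (x ∷ []) (t ∷ st) rest S<c (x<c ∷ []) (c<t ∷ c<st)
  stackRun-split-∷ x S (t ∷ u) st rest x<c S<c (t<c ∷ u<c) c<st with x <ᵇ t
  ... | true = stackRun-split S (x ∷ t ∷ u) st rest S<c (x<c ∷ t<c ∷ u<c) c<st
  ... | false = cong (t ∷_) (stackRun-split-∷ x S u st rest x<c S<c u<c c<st)

mutual
  stackRun-bottom : ∀ {M} Q u → All (_< M) Q → All (_< M) u → stackRun Q (u ++ M ∷ []) ≡ stackRun Q u ++ M ∷ []
  stackRun-bottom [] u _ _ = refl
  stackRun-bottom (x ∷ Q) u (x<M ∷ Q<M) u<M = stackRun-bottom-∷ x Q u x<M Q<M u<M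

  stackRun-bottom-∷ : ∀ {M} x Q u → x < M → All (_< M) Q → All (_< M) u →
    stackRun (x ∷ Q) (u ++ M ∷ []) ≡ stackRun (x ∷ Q) u ++ M ∷ []
  stackRun-bottom-∷ x Q [] x<M Q<M _ rewrite <⇒<ᵇ≡true x<M = stackRun-bottom Q (x ∷ []) Q<M (x<M ∷ [])
  stackRun-bottom-∷ x Q (t ∷ u) x<M Q<M (t<M ∷ u<M) with x <ᵇ t
  ... | true = stackRun-bottom Q (x ∷ t ∷ u) Q<M (x<M ∷ t<M ∷ u<M)
  ... | false = cong (t ∷_) (stackRun-bottom-∷ x Q u x<M Q<M u<M)

below-unique-max : ∀ P Q {M} → Unique (P ++ M ∷ Q) → All (_≤ M) (P ++ M ∷ Q) → All (_< M) P × All (_< M) Q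
below-unique-max P Q u ≤M =
  All.tabulate (λ {x} x∈ → ≤∧≢⇒< (All.lookup ≤M (∈-++⁺ˡ x∈)) (λ e → Unique-middle∉ˡ P u (subst (_∈ P) e x∈))) ,
  All.tabulate (λ {x} x∈ → ≤∧≢⇒< (All.lookup ≤M (∈-++⁺ʳ P (there x∈))) (λ e → Unique-middle∉ʳ P u (subst (_∈ Q) e x∈)))

s-ends-with-max : ∀ S {M} → M ∈ S → All (_≤ M) S → Unique S → Σ (List ℕ) λ A → s S ≡ A ++ M ∷ []
s-ends-with-max S {M} M∈ ≤M u with ∈-∃++ M∈
... | P , Q , refl with below-unique-max P Q u ≤M
... | P<M , Q<M = stackRun P [] ++ stackRun Q [] , (begin
    stackRun (P ++ M ∷ Q) ([] ++ [])         ≡⟨ stackRun-split P [] [] Q P<M [] [] ⟩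
    stackRun P [] ++ stackRun Q (M ∷ [])     ≡⟨ cong (stackRun P [] ++_) (stackRun-bottom Q [] Q<M []) ⟩
    stackRun P [] ++ (stackRun Q [] ++ M ∷ []) ≡⟨ sym (++-assoc (stackRun P []) _ _) ⟩
    (stackRun P [] ++ stackRun Q []) ++ M ∷ [] ∎)
  where open ≡-Reasoning

increasing-0-false : ∀ z Z τ → increasing (z ∷ Z ++ 0 ∷ τ) ≡ false
increasing-0-false z [] τ rewrite ≤⇒<ᵇ≡false {z} {0} z≤n = refl
increasing-0-false z (z′ ∷ Z) τ rewrite increasing-0-false z′ Z τ = ∧-zeroʳ (z <ᵇ z′)

Blocks : Set
Blocks = List (List ℕ × ℕ)

flatten : Blocks → List ℕ
flatten [] = []
flatten ((b , c) ∷ r) = b ++ c ∷ flatten r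

sortEach : Blocks → List ℕ
sortEach [] = []
sortEach ((b , c) ∷ r) = s b ++ sortEach r

keys : Blocks → List ℕ
keys = map proj₂

data Decreasing : Blocks → Set where
  []  : Decreasing []
  _∷_ : ∀ {b c r} → All (_< c) b × All (_< c) (flatten r) → Decreasing r → Decreasing ((b , c) ∷ r)

∈-keys⇒∈-flatten : ∀ D {x} → x ∈ keys D → x ∈ flatten D
∈-keys⇒∈-flatten ((b , c) ∷ r) (here refl) = ∈-++⁺ʳ b (here refl)
∈-keys⇒∈-flatten ((b , c) ∷ r) (there x∈) = ∈-++⁺ʳ b (there (∈-keys⇒∈-flatten r x∈))

keys-⊆-flatten : ∀ D → keys D ⊆ flatten D
keys-⊆-flatten [] = []
keys-⊆-flatten ((b , c) ∷ r) = ++⁺ˡ b (refl ∷ keys-⊆-flatten r)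

∈-sortEach⁻ : ∀ D {x} → x ∈ sortEach D → x ∈ flatten D
∈-sortEach⁻ ((b , c) ∷ r) x∈ with ∈-++⁻ (s b) x∈
... | inj₁ x∈b = ∈-++⁺ˡ (∈-resp-↭ (s-↭ b) x∈b)
... | inj₂ x∈r = ∈-++⁺ʳ b (there (∈-sortEach⁻ r x∈r))

∈-sortEach⁺ : ∀ D {b c y} → (b , c) ∈ D → y ∈ b → y ∈ sortEach D
∈-sortEach⁺ ((b , c) ∷ D) (here refl) y∈b = ∈-++⁺ˡ (∈-resp-↭ (↭-sym (s-↭ b)) y∈b)
∈-sortEach⁺ ((b′ , c′) ∷ D) (there e∈) y∈b = ∈-++⁺ʳ (s b′) (∈-sortEach⁺ D e∈ y∈b)

stackRun-blocks : ∀ D τ st → Decreasing D → All (0 <_) (flatten D) → All (0 <_) st →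
  (∀ {x y} → x ∈ flatten D → y ∈ st → x < y) →
  Σ (List ℕ) λ X → All (0 <_) X × stackRun (flatten D ++ 0 ∷ τ) st ≡ sortEach D ++ stackRun (0 ∷ τ) X
stackRun-blocks [] τ st _ _ st>0 _ = st , st>0 , refl
stackRun-blocks ((b , c) ∷ r) τ st ((b<c , r<c) ∷ decr) pos st>0 below
  with stackRun-blocks r τ (c ∷ st) decr (All.tabulate λ x∈ → All.lookup pos (∈-++⁺ʳ b (there x∈)))
         (All.lookup pos (∈-++⁺ʳ b (here refl)) ∷ st>0)
         (λ { x∈ (here refl) → All.lookup r<c x∈ ; x∈ (there y∈) → below (∈-++⁺ʳ b (there x∈)) y∈ })
... | X , X>0 , eq = X , X>0 , (begin
   stackRun ((b ++ c ∷ flatten r) ++ 0 ∷ τ) st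
     ≡⟨ cong (λ z → stackRun z st) (++-assoc b (c ∷ flatten r) (0 ∷ τ)) ⟩
   stackRun (b ++ c ∷ (flatten r ++ 0 ∷ τ)) ([] ++ st)
     ≡⟨ stackRun-split b [] st (flatten r ++ 0 ∷ τ) b<c [] (All.tabulate (below (∈-++⁺ʳ b (here refl)))) ⟩
   s b ++ stackRun (flatten r ++ 0 ∷ τ) (c ∷ st)
     ≡⟨ cong (s b ++_) eq ⟩
   s b ++ (sortEach r ++ stackRun (0 ∷ τ) X)
     ≡⟨ sym (++-assoc (s b) (sortEach r) _) ⟩
   (s b ++ sortEach r) ++ stackRun (0 ∷ τ) X ∎)
  where
  open ≡-Reasoning

stackRun-0-on-top : ∀ τ w → Σ (List ℕ) λ W → stackRun τ (0 ∷ w) ≡ 0 ∷ W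
stackRun-0-on-top [] w = w , refl
stackRun-0-on-top (y ∷ τ) w rewrite ≤⇒<ᵇ≡false {y} {0} z≤n = _ , refl

stackRun-from-0 : ∀ τ X → All (0 <_) X → Σ (List ℕ) λ W → stackRun (0 ∷ τ) X ≡ 0 ∷ W
stackRun-from-0 τ [] _ = stackRun-0-on-top τ []
stackRun-from-0 τ (t ∷ X) (0<t ∷ _) rewrite <⇒<ᵇ≡true 0<t = stackRun-0-on-top τ (t ∷ X)

s-blocks : ∀ D τ → Decreasing D → All (0 <_) (flatten D) →
  Σ (List ℕ) λ W → s (flatten D ++ 0 ∷ τ) ≡ sortEach D ++ 0 ∷ W
s-blocks D τ decr pos with stackRun-blocks D τ [] decr pos [] (λ _ ())
... | X , X>0 , eq with stackRun-from-0 τ X X>0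
... | W , eq′ = W , trans eq (cong (sortEach D ++_) eq′)

length-after : ∀ A {M} (B : List ℕ) → length B < length (A ++ M ∷ B)
length-after [] B = ≤-refl
length-after (a ∷ A) B = m≤n⇒m≤1+n (length-after A B)

record SplitAtMax (L : List ℕ) : Set where
  constructor splitAt
  field
    before : List ℕ
    max : ℕ
    after : List ℕ
    L≡ : L ≡ before ++ max ∷ after
    max∉before : max ∉ before
    max∉after : max ∉ after
    ≤max : All (_≤ max) L

chain-unfold : ∀ f L {y} → Unique L → y ∈ L →
  Σ (SplitAtMax L) λ sp → chain (suc f) L ≡ (SplitAtMax.before sp , SplitAtMax.max sp) ∷ chain f (SplitAtMax.after sp)
chain-unfold f (z ∷ zs) u _ with split-at-member u (max-∈ z zs)
... | A , B , eq , M∉A , M∉B =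
  splitAt A (foldr _⊔_ z zs) B eq M∉A M∉B (max-greatest z zs) ,
  cong (λ p → (proj₁ p , foldr _⊔_ z zs) ∷ chain f (proj₂ p)) (trans (cong (cut (foldr _⊔_ z zs)) eq) (cut-++ _ A B M∉A))

chain-step : ∀ f X M Y → M ∉ X → All (_≤ M) (X ++ M ∷ Y) → chain (suc f) (X ++ M ∷ Y) ≡ (X , M) ∷ chain f Y
chain-step f X M Y M∉X ≤M = go (X ++ M ∷ Y) refl
  where
  go : ∀ L → L ≡ X ++ M ∷ Y → chain (suc f) L ≡ (X , M) ∷ chain f Y
  go [] e = ⊥-elim (nonempty X e)
    where
    nonempty : ∀ X → [] ≢ X ++ M ∷ Y
    nonempty [] ()
    nonempty (_ ∷ _) ()
  go (z ∷ zs) e rewrite max-≡ z zs (subst (M ∈_) (sym e) (∈-++⁺ʳ X (here refl))) (subst (All (_≤ M)) (sym e) ≤M) =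
    cong (λ p → (proj₁ p , M) ∷ chain f (proj₂ p)) (trans (cong (cut M) e) (cut-++ M X Y M∉X))

chain-flatten : ∀ f D → Decreasing D → length D ≤ f → chain f (flatten D) ≡ D
chain-flatten zero [] _ _ = refl
chain-flatten (suc f) [] _ _ = refl
chain-flatten (suc f) ((b , c) ∷ r) ((b<c , r<c) ∷ decr) (s≤s len≤f) =
  trans (chain-step f b c (flatten r) (λ c∈b → <-irrefl refl (All.lookup b<c c∈b)) (All-++ (All.map <⇒≤ b<c) (≤-refl ∷ All.map <⇒≤ r<c)))
        (cong ((b , c) ∷_) (chain-flatten f r decr len≤f))
  where
  All-++ : ∀ {P : ℕ → Set} {A B} → All P A → All P B → All P (A ++ B)
  All-++ [] pB = pB
  All-++ (p ∷ pA) pB = p ∷ All-++ pA pB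

keys-chain-⊆ : ∀ f L → Unique L → ∀ {x} → x ∈ keys (chain f L) → x ∈ L
keys-chain-⊆ (suc f) (z ∷ zs) u {x} x∈ with chain-unfold f (z ∷ zs) u (here refl)
... | splitAt A M B L≡ _ _ _ , eq = subst (x ∈_) (sym L≡) (go (subst (λ q → x ∈ keys q) eq x∈))
  where
  go : x ∈ M ∷ keys (chain f B) → x ∈ A ++ M ∷ B
  go (here refl) = ∈-++⁺ʳ A (here refl)
  go (there x∈′) = ∈-++⁺ʳ A (there (keys-chain-⊆ f B (Unique-middle⁻ A (subst Unique L≡ u)) x∈′))

flatten-chain-⊆ : ∀ f L → Unique L → ∀ {x} → x ∈ flatten (chain f L) → x ∈ L
flatten-chain-⊆ (suc f) (z ∷ zs) u {x} x∈ with chain-unfold f (z ∷ zs) u (here refl)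
... | splitAt A M B L≡ _ _ _ , eq = subst (x ∈_) (sym L≡) (go (∈-++⁻ A (subst (λ q → x ∈ flatten q) eq x∈)))
  where
  go : x ∈ A ⊎ x ∈ M ∷ flatten (chain f B) → x ∈ A ++ M ∷ B
  go (inj₁ x∈A) = ∈-++⁺ˡ x∈A
  go (inj₂ (here refl)) = ∈-++⁺ʳ A (here refl)
  go (inj₂ (there x∈′)) = ∈-++⁺ʳ A (there (flatten-chain-⊆ f B (Unique-middle⁻ A (subst Unique L≡ u)) x∈′))

flatten-chain : ∀ f L → Unique L → length L ≤ f → flatten (chain f L) ≡ L
flatten-chain zero [] _ _ = refl
flatten-chain (suc f) [] _ _ = refl
flatten-chain (suc f) (z ∷ zs) u (s≤s len≤f) with chain-unfold f (z ∷ zs) u (here refl)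
... | splitAt A M B eq _ _ _ , ceq = begin
   flatten (chain (suc f) (z ∷ zs)) ≡⟨ cong flatten ceq ⟩
   A ++ M ∷ flatten (chain f B)     ≡⟨ cong (λ q → A ++ M ∷ q) (flatten-chain f B uB lenB) ⟩
   A ++ M ∷ B                       ≡⟨ sym eq ⟩
   z ∷ zs ∎
  where
  open ≡-Reasoning
  uB = Unique-middle⁻ A (subst Unique eq u)
  lenB = ≤-trans (≤-pred (subst (λ q → length B < length q) (sym eq) (length-after A B))) len≤f

chain-decreasing : ∀ f L → Unique L → Decreasing (chain f L)
chain-decreasing zero L u = []
chain-decreasing (suc f) [] u = []
chain-decreasing (suc f) (z ∷ zs) u with chain-unfold f (z ∷ zs) u (here refl)
... | splitAt A M B eq M∉A M∉B ≤M , ceq = subst Decreasing (sym ceq) ((A<M , rest<M) ∷ chain-decreasing f B uB)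
  where
  uB = Unique-middle⁻ A (subst Unique eq u)
  A<M : All (_< M) A
  A<M = All.tabulate (λ {x} x∈ → ≤∧≢⇒< (All.lookup ≤M (subst (x ∈_) (sym eq) (∈-++⁺ˡ x∈))) (λ e → M∉A (subst (_∈ A) e x∈)))
  rest<M : All (_< M) (flatten (chain f B))
  rest<M = All.tabulate (λ {x} x∈ → let x∈B = flatten-chain-⊆ f B uB x∈ in
    ≤∧≢⇒< (All.lookup ≤M (subst (x ∈_) (sym eq) (∈-++⁺ʳ A (there x∈B)))) (λ e → M∉B (subst (_∈ B) e x∈B)))

-- The first maximum M of b ++ c ∷ rest is a key of (b , c) ∷ D, and c is a key of the
-- chain from M on; if M came after c, then c would have to occur after M.
first-max-is-first-key : ∀ f b c D E A M B → Unique (b ++ c ∷ (flatten D ++ E)) →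
  b ++ c ∷ (flatten D ++ E) ≡ A ++ M ∷ B → M ∉ A →
  M ∈ c ∷ keys D → c ∈ M ∷ keys (chain f B) → M ≡ c
first-max-is-first-key f b c D E A M B u eq M∉A (here M≡c) _ = M≡c
first-max-is-first-key f b c D E A M B u eq M∉A (there M∈D) (here c≡M) = sym c≡M
first-max-is-first-key f b c D E A M B u eq M∉A (there M∈D) (there c∈B) = ⊥-elim (c∉rest c∈rest)
  where
  rest = flatten D ++ E
  c∉rest : c ∉ rest
  c∉rest = Unique-middle∉ʳ b u
  M∈rest : M ∈ rest
  M∈rest = ∈-++⁺ˡ (∈-keys⇒∈-flatten D M∈D)
  B≡ : B ≡ proj₂ (cut M rest)
  B≡ = trans (sym (cong proj₂ (cut-++ M A B M∉A)))
         (trans (cong (λ q → proj₂ (cut M q)) (sym eq))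
                (cut-after-skip M b c rest (λ M∈b → Unique-++⇒disjoint b u M∈b (there M∈rest))
                                           (λ M≡c → c∉rest (subst (_∈ rest) M≡c M∈rest))))
  c∈rest : c ∈ rest
  c∈rest = cut-after-⊆ M rest (subst (c ∈_) B≡ (keys-chain-⊆ f B (Unique-middle⁻ A (subst Unique eq u)) c∈B))

nonempty-length : ∀ (b : List ℕ) {c} {r} → 0 < length (b ++ c ∷ r)
nonempty-length [] = s≤s z≤n
nonempty-length (_ ∷ _) = s≤s z≤n

chain-peel : ∀ f b c D E → Unique (b ++ c ∷ (flatten D ++ E)) →
  (∀ {x} → x ∈ keys (chain (suc f) (b ++ c ∷ (flatten D ++ E))) → x ∈ c ∷ keys D) →
  c ∈ keys (chain (suc f) (b ++ c ∷ (flatten D ++ E))) →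
  chain (suc f) (b ++ c ∷ (flatten D ++ E)) ≡ (b , c) ∷ chain f (flatten D ++ E)
chain-peel f b c D E u ⊆cD c∈ with chain-unfold f (b ++ c ∷ (flatten D ++ E)) u (∈-++⁺ʳ b (here refl))
... | splitAt A M B L≡ M∉A _ _ , ceq =
  trans ceq (cong₂ (λ p q → p ∷ chain f q) (cong₂ _,_ (proj₁ A≡b×B≡rest) M≡c) (proj₂ A≡b×B≡rest))
  where
  rest = flatten D ++ E
  M≡c : M ≡ c
  M≡c = first-max-is-first-key f b c D E A M B u L≡ M∉A
          (⊆cD (subst (λ q → M ∈ keys q) (sym ceq) (here refl))) (subst (λ q → c ∈ keys q) ceq c∈)
  A≡b×B≡rest : A ≡ b × B ≡ rest
  A≡b×B≡rest = cut-++-unique A B b rest M∉A (subst (_∉ b) (sym M≡c) (Unique-middle∉ˡ b u))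
                 (trans (sym L≡) (cong (λ q → b ++ q ∷ rest) (sym M≡c)))

chain-determined-by-keys : ∀ f D E → Unique (flatten D ++ E) → length (flatten D ++ E) ≤ f →
  (∀ {x} → x ∈ keys (chain f (flatten D ++ E)) → x ∈ keys D) →
  (∀ {x} → x ∈ keys D → x ∈ keys (chain f (flatten D ++ E))) →
  chain f (flatten D ++ E) ≡ D × E ≡ []
chain-determined-by-keys zero [] [] _ _ _ _ = refl , refl
chain-determined-by-keys (suc f) [] [] _ _ _ _ = refl , refl
chain-determined-by-keys zero [] (e ∷ E) _ () _ _
chain-determined-by-keys (suc f) [] (e ∷ E) u _ ⊆D _ with chain-unfold f (e ∷ E) u (here refl)
... | splitAt _ M _ _ _ _ _ , ceq with ⊆D (subst (λ q → M ∈ keys q) (sym ceq) (here refl))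
... | ()
chain-determined-by-keys zero ((b , c) ∷ D) E _ len≤0 _ _ =
  ⊥-elim (<⇒≱ (subst (λ q → 0 < length q) (sym (++-assoc b (c ∷ flatten D) E)) (nonempty-length b)) len≤0)
chain-determined-by-keys (suc f) ((b , c) ∷ D) E u len≤f ⊆D D⊆ = trans peel (cong ((b , c) ∷_) (proj₁ ih)) , proj₂ ih
  where
  rest = flatten D ++ E
  assoc : (b ++ c ∷ flatten D) ++ E ≡ b ++ c ∷ rest
  assoc = ++-assoc b (c ∷ flatten D) E
  u′ : Unique (b ++ c ∷ rest)
  u′ = subst Unique assoc u
  peel : chain (suc f) ((b ++ c ∷ flatten D) ++ E) ≡ (b , c) ∷ chain f rest
  peel = trans (cong (chain (suc f)) assoc)
    (chain-peel f b c D E u′ (λ x∈ → ⊆D (subst (λ l → _ ∈ keys (chain (suc f) l)) (sym assoc) x∈))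
                             (subst (λ l → c ∈ keys (chain (suc f) l)) assoc (D⊆ (here refl))))
  tail⊆D : ∀ {x} → x ∈ keys (chain f rest) → x ∈ keys D
  tail⊆D {x} x∈ with ⊆D (subst (λ q → x ∈ keys q) (sym peel) (there x∈))
  ... | here refl = ⊥-elim (Unique-middle∉ʳ b u′ (keys-chain-⊆ f rest (Unique-middle⁻ b u′) x∈))
  ... | there x∈D = x∈D
  D⊆tail : ∀ {x} → x ∈ keys D → x ∈ keys (chain f rest)
  D⊆tail {x} x∈D with subst (λ q → x ∈ keys q) peel (D⊆ (there x∈D))
  ... | here refl = ⊥-elim (Unique-middle∉ʳ b u′ (∈-++⁺ˡ (∈-keys⇒∈-flatten D x∈D)))
  ... | there x∈ = x∈
  ih : chain f rest ≡ D × E ≡ []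
  ih = chain-determined-by-keys f D E (Unique-middle⁻ b u′)
         (≤-pred (≤-trans (subst (λ q → length rest < length q) (sym assoc) (length-after b rest)) len≤f)) tail⊆D D⊆tail

module Setting (n : ℕ) (α : List ℕ) (comp : IsComposition n α) (T : ℕ → ℕ × ℕ) (LE : IsLinearExtension n α T)
               (π ρ : List ℕ) (perm : π ↭ upTo (suc n)) (π≡ : π ≡ ρ ++ 0 ∷ []) where

  m : ℕ
  m = length α

  rows : List ℕ
  rows = range 1 m

  colT rowT : ℕ → ℕ
  colT x = proj₁ (T x)
  rowT x = proj₂ (T x)

  Entry : ℕ → Set
  Entry x = 1 ≤ x × x ≤ n

  T⁻¹ : ℕ → ℕ → ℕ
  T⁻¹ i j = Tinv n T (i , j)

  row-lower : ∀ {j} → j ∈ rows → 1 ≤ j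
  row-lower = lower-bound-range

  row-upper : ∀ {j} → j ∈ rows → j ≤ m
  row-upper j∈ = ≤-pred (upper-bound-range j∈)

  ∈-rows : ∀ {j} → 1 ≤ j → j ≤ m → j ∈ rows
  ∈-rows lo hi = ∈-range lo (s≤s hi)

  ∈-oneTo : ∀ {x N} → 1 ≤ x → x ≤ N → x ∈ oneTo N
  ∈-oneTo {x} {N} lo hi = subst (x ∈_) (sym (oneTo≡range N)) (∈-range lo (s≤s hi))

  ∈-oneTo⁻ : ∀ {x} → x ∈ oneTo n → Entry x
  ∈-oneTo⁻ x∈ = let x∈′ = subst (_ ∈_) (oneTo≡range n) x∈ in lower-bound-range x∈′ , ≤-pred (upper-bound-range x∈′)

  T∈D : ∀ x → Entry x → InD α (T x)
  T∈D x (lo , hi) = proj₁ LE x lo hi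

  T-injective : ∀ x y → Entry x → Entry y → T x ≡ T y → x ≡ y
  T-injective x y (lo , hi) (lo′ , hi′) = proj₁ (proj₂ LE) x y lo hi lo′ hi′

  T-surjective : ∀ p → InD α p → Σ ℕ λ x → Entry x × T x ≡ p
  T-surjective p p∈D with proj₁ (proj₂ (proj₂ LE)) p p∈D
  ... | x , lo , hi , Tx≡p = x , (lo , hi) , Tx≡p

  T-monotone : ∀ x y → Entry x → Entry y → colT x ≤ colT y → rowT x ≤ rowT y → y ≤ x
  T-monotone x y (lo , hi) (lo′ , hi′) c≤ r≤ = proj₂ (proj₂ (proj₂ LE)) x y lo hi lo′ hi′ (c≤ , r≤)

  T⁻¹-spec : ∀ i j → InD α (i , j) → Entry (T⁻¹ i j) × T (T⁻¹ i j) ≡ (i , j)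
  T⁻¹-spec i j ij∈D with T-surjective (i , j) ij∈D
  ... | x , x∈ , Tx≡ = subst Entry (sym T⁻¹≡x) x∈ , trans (cong T T⁻¹≡x) Tx≡
    where
    hit : ℕ → Maybe ℕ
    hit x = if (colT x ≡ᵇ i) ∧ (rowT x ≡ᵇ j) then just x else nothing
    hit-x : hit x ≡ just x
    hit-x rewrite Tx≡ | ≡ᵇ-refl i | ≡ᵇ-refl j = refl
    miss : ∀ y → y ∈ oneTo n → y ≢ x → hit y ≡ nothing
    miss y y∈ y≢x with colT y ≡ᵇ i in ci | rowT y ≡ᵇ j in rj
    ... | true | true = ⊥-elim (y≢x (T-injective y x (∈-oneTo⁻ y∈) x∈
                          (trans (cong₂ _,_ (≡ᵇ≡true⇒≡ ci) (≡ᵇ≡true⇒≡ rj)) (sym Tx≡))))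
    ... | true | false = refl
    ... | false | _ = refl
    T⁻¹≡x : T⁻¹ i j ≡ x
    T⁻¹≡x with firstJust (oneTo n) hit | firstJust-unique (oneTo n) hit (∈-oneTo (proj₁ x∈) (proj₂ x∈)) hit-x miss
    ... | just (x′ , _) | refl = refl

  Entry-T⁻¹ : ∀ {i j} → InD α (i , j) → Entry (T⁻¹ i j)
  Entry-T⁻¹ ij∈D = proj₁ (T⁻¹-spec _ _ ij∈D)

  colT-T⁻¹ : ∀ {i j} → InD α (i , j) → colT (T⁻¹ i j) ≡ i
  colT-T⁻¹ ij∈D = cong proj₁ (proj₂ (T⁻¹-spec _ _ ij∈D))

  rowT-T⁻¹ : ∀ {i j} → InD α (i , j) → rowT (T⁻¹ i j) ≡ j
  rowT-T⁻¹ ij∈D = cong proj₂ (proj₂ (T⁻¹-spec _ _ ij∈D))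

  T⁻¹-T : ∀ x → Entry x → T⁻¹ (colT x) (rowT x) ≡ x
  T⁻¹-T x x∈ = T-injective _ x (Entry-T⁻¹ (T∈D x x∈)) x∈ (proj₂ (T⁻¹-spec _ _ (T∈D x x∈)))

  T⁻¹-at-col : ∀ {x i} → Entry x → colT x ≡ i → T⁻¹ i (rowT x) ≡ x
  T⁻¹-at-col x∈ refl = T⁻¹-T _ x∈

  first-column : ∀ {j} → 1 ≤ j → j ≤ m → InD α (1 , j)
  first-column lo hi = ≤-refl , lo , hi , at-positive α _ lo hi (proj₁ comp)

  weaken-column : ∀ {k j} → InD α (suc (suc k) , j) → InD α (suc k , j)
  weaken-column (_ , lo , hi , reach) = s≤s z≤n , lo , hi , ≤-trans (n≤1+n _) reach

  colT-positive : ∀ x → Entry x → Σ ℕ λ k → colT x ≡ suc k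
  colT-positive x x∈ with colT x | proj₁ (T∈D x x∈)
  ... | suc k | _ = k , refl

  Unique-π : Unique π
  Unique-π = Unique-resp-↭ (setoid ℕ) (↭⇒↭ₛ (↭-sym perm)) (upTo⁺ (suc n))

  Unique-ρ : Unique ρ
  Unique-ρ = Unique-++⁻ˡ ρ (subst Unique π≡ Unique-π)

  ∈-π⇒≤n : ∀ {x} → x ∈ π → x ≤ n
  ∈-π⇒≤n x∈ = ≤-pred (∈-upTo⁻ (∈-resp-↭ perm x∈))

  ≤n⇒∈-π : ∀ {x} → x ≤ n → x ∈ π
  ≤n⇒∈-π x≤n = ∈-resp-↭ (↭-sym perm) (∈-upTo⁺ (s≤s x≤n))

  Entry⇒∈-ρ : ∀ {x} → Entry x → x ∈ ρ
  Entry⇒∈-ρ {x} (lo , hi) with ∈-++⁻ ρ (subst (x ∈_) π≡ (≤n⇒∈-π hi))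
  ... | inj₁ x∈ρ = x∈ρ
  ... | inj₂ (here refl) = ⊥-elim (<⇒≱ lo z≤n)

  Unique-iter : ∀ k → Unique (iter k π)
  Unique-iter k = Unique-resp-↭ (setoid ℕ) (↭⇒↭ₛ (↭-sym (iter-↭ k π))) Unique-π

  length-iter : ∀ k → length (iter k π) ≡ suc n
  length-iter k = trans (↭-length (iter-↭ k π)) (trans (↭-length perm) (length-upTo (suc n)))

  left : ℕ → List ℕ
  left i = proj₁ (cut 0 (iter (i ∸ 1) π))

  iter≡left++0 : ∀ k → Σ (List ℕ) λ τ → iter k π ≡ left (suc k) ++ 0 ∷ τ × 0 ∉ left (suc k)
  iter≡left++0 k with split-at-member (Unique-iter k) (∈-resp-↭ (↭-sym (iter-↭ k π)) (≤n⇒∈-π z≤n))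
  ... | A , B , eq , 0∉A , _ = B , trans eq (cong (λ z → z ++ 0 ∷ B) (sym left≡A)) , subst (0 ∉_) (sym left≡A) 0∉A
    where
    left≡A : left (suc k) ≡ A
    left≡A = trans (cong (λ z → proj₁ (cut 0 z)) eq) (cong proj₁ (cut-++ 0 A B 0∉A))

  Unique-left : ∀ k → Unique (left (suc k))
  Unique-left k with iter≡left++0 k
  ... | τ , eq , _ = Unique-++⁻ˡ (left (suc k)) (subst Unique eq (Unique-iter k))

  ∈-left⇒Entry : ∀ k {x} → x ∈ left (suc k) → Entry x
  ∈-left⇒Entry k {x} x∈ with iter≡left++0 k
  ... | τ , eq , 0∉ = positive x∈ 0∉ , ∈-π⇒≤n (∈-resp-↭ (iter-↭ k π) (subst (x ∈_) (sym eq) (∈-++⁺ˡ x∈)))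
    where
    positive : ∀ {x} {l : List ℕ} → x ∈ l → 0 ∉ l → 1 ≤ x
    positive {zero} x∈ 0∉ = ⊥-elim (0∉ x∈)
    positive {suc x} _ _ = s≤s z≤n

  length-left : ∀ k → length (left (suc k)) ≤ length (iter k π)
  length-left k = length-cut-before 0 (iter k π)

  left1≡ρ : left 1 ≡ ρ
  left1≡ρ = trans (cong (λ z → proj₁ (cut 0 z)) π≡) (cong proj₁ (cut-++ 0 ρ [] (Unique-middle∉ˡ ρ (subst Unique π≡ Unique-π))))

  increasing-iter-false : ∀ k {x} → x ∈ left (suc k) → increasing (iter k π) ≡ false
  increasing-iter-false k x∈ with iter≡left++0 k
  ... | τ , eq , _ = trans (cong increasing eq) (nonempty (left (suc k)) x∈)
    where
    nonempty : ∀ (l : List ℕ) {x} → x ∈ l → increasing (l ++ 0 ∷ τ) ≡ false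
    nonempty (z ∷ Z) _ = increasing-0-false z Z τ

  layerBlocks : ℕ → (ℕ → List ℕ) → List ℕ → Blocks
  layerBlocks i blk [] = []
  layerBlocks i blk (j ∷ js) = if i ≤ᵇ at α j then (blk j , T⁻¹ i j) ∷ layerBlocks i blk js else layerBlocks i blk js

  layerBlocks-reaching : ∀ i blk j js → i ≤ at α j → layerBlocks i blk (j ∷ js) ≡ (blk j , T⁻¹ i j) ∷ layerBlocks i blk js
  layerBlocks-reaching i blk j js i≤ rewrite ≤⇒≤ᵇ≡true i≤ = refl

  layerBlocks-short : ∀ i blk j js → at α j < i → layerBlocks i blk (j ∷ js) ≡ layerBlocks i blk js
  layerBlocks-short i blk j js short rewrite >⇒≤ᵇ≡false short = refl

  blockOrEmpty : ℕ → (ℕ → List ℕ) → ℕ → List ℕ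
  blockOrEmpty i blk j = if i ≤ᵇ at α j then blk j ++ T⁻¹ i j ∷ [] else []

  flatten-layerBlocks : ∀ i blk js → flatten (layerBlocks i blk js) ≡ concat (map (blockOrEmpty i blk) js)
  flatten-layerBlocks i blk [] = refl
  flatten-layerBlocks i blk (j ∷ js) with i ≤ᵇ at α j
  ... | true = trans (cong (λ z → blk j ++ T⁻¹ i j ∷ z) (flatten-layerBlocks i blk js)) (sym (++-assoc (blk j) (T⁻¹ i j ∷ []) _))
  ... | false = flatten-layerBlocks i blk js

  ∈-layerBlocks⁻ : ∀ i blk js {b c} → (b , c) ∈ layerBlocks i blk js →
    Σ ℕ λ j → j ∈ js × i ≤ at α j × b ≡ blk j × c ≡ T⁻¹ i j
  ∈-layerBlocks⁻ i blk (j ∷ js) e∈ with i ≤ᵇ at α j in i≤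
  ... | true with e∈
  ...   | here refl = j , here refl , ≤ᵇ≡true⇒≤ i≤ , refl , refl
  ...   | there e∈′ = let (j′ , j∈ , rest) = ∈-layerBlocks⁻ i blk js e∈′ in j′ , there j∈ , rest
  ∈-layerBlocks⁻ i blk (j ∷ js) e∈ | false = let (j′ , j∈ , rest) = ∈-layerBlocks⁻ i blk js e∈ in j′ , there j∈ , rest

  ∈-layerBlocks⁺ : ∀ i blk js {j} → j ∈ js → i ≤ at α j → (blk j , T⁻¹ i j) ∈ layerBlocks i blk js
  ∈-layerBlocks⁺ i blk (j ∷ js) (here refl) i≤ rewrite ≤⇒≤ᵇ≡true i≤ = here refl
  ∈-layerBlocks⁺ i blk (j′ ∷ js) (there j∈) i≤ with i ≤ᵇ at α j′
  ... | true = there (∈-layerBlocks⁺ i blk js j∈ i≤)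
  ... | false = ∈-layerBlocks⁺ i blk js j∈ i≤

  ∈-keys-layerBlocks⁻ : ∀ i blk js {x} → x ∈ keys (layerBlocks i blk js) → Σ ℕ λ j → j ∈ js × i ≤ at α j × x ≡ T⁻¹ i j
  ∈-keys-layerBlocks⁻ i blk js x∈ with ∈-map⁻ proj₂ x∈
  ... | _ , e∈ , refl with ∈-layerBlocks⁻ i blk js e∈
  ...   | j , j∈ , i≤ , _ , c≡ = j , j∈ , i≤ , c≡

  ∈-keys-layerBlocks⁺ : ∀ i blk js {j} → j ∈ js → i ≤ at α j → T⁻¹ i j ∈ keys (layerBlocks i blk js)
  ∈-keys-layerBlocks⁺ i blk js j∈ i≤ = ∈-map⁺ proj₂ (∈-layerBlocks⁺ i blk js j∈ i≤)

  ∈-flatten-layerBlocks⁻ : ∀ i blk js {y} → y ∈ flatten (layerBlocks i blk js) →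
    Σ ℕ λ j → j ∈ js × i ≤ at α j × (y ∈ blk j ⊎ y ≡ T⁻¹ i j)
  ∈-flatten-layerBlocks⁻ i blk (j ∷ js) y∈ with i ≤ᵇ at α j in i≤
  ... | true with ∈-++⁻ (blk j) y∈
  ...   | inj₁ y∈b = j , here refl , ≤ᵇ≡true⇒≤ i≤ , inj₁ y∈b
  ...   | inj₂ (here refl) = j , here refl , ≤ᵇ≡true⇒≤ i≤ , inj₂ refl
  ...   | inj₂ (there y∈′) = let (j′ , j∈ , rest) = ∈-flatten-layerBlocks⁻ i blk js y∈′ in j′ , there j∈ , rest
  ∈-flatten-layerBlocks⁻ i blk (j ∷ js) y∈ | false =
    let (j′ , j∈ , rest) = ∈-flatten-layerBlocks⁻ i blk js y∈ in j′ , there j∈ , rest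

  layerBlocks-cong : ∀ i f g js → (∀ {j} → j ∈ js → f j ≡ g j) → layerBlocks i f js ≡ layerBlocks i g js
  layerBlocks-cong i f g [] _ = refl
  layerBlocks-cong i f g (j ∷ js) f≡g with i ≤ᵇ at α j
  ... | true = cong₂ (λ u v → (u , T⁻¹ i j) ∷ v) (f≡g (here refl)) (layerBlocks-cong i f g js (f≡g ∘ there))
  ... | false = layerBlocks-cong i f g js (f≡g ∘ there)

  layerBlocks-all : ∀ i blk js → (∀ {j} → j ∈ js → i ≤ at α j) → layerBlocks i blk js ≡ map (λ j → (blk j , T⁻¹ i j)) js
  layerBlocks-all i blk [] _ = refl
  layerBlocks-all i blk (j ∷ js) reach rewrite ≤⇒≤ᵇ≡true (reach (here refl)) =
    cong ((blk j , T⁻¹ i j) ∷_) (layerBlocks-all i blk js (reach ∘ there))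

  firstLayerBlocks : ∀ blk → layerBlocks 1 blk rows ≡ map (λ j → (blk j , T⁻¹ 1 j)) rows
  firstLayerBlocks blk = layerBlocks-all 1 blk rows (λ j∈ → proj₂ (proj₂ (proj₂ (first-column (row-lower j∈) (row-upper j∈)))))

  flatten-map : ∀ (blk : ℕ → List ℕ) (d : ℕ → ℕ) js → flatten (map (λ j → (blk j , d j)) js) ≡ concat (map (λ j → blk j ++ d j ∷ []) js)
  flatten-map blk d [] = refl
  flatten-map blk d (j ∷ js) = trans (cong (λ z → blk j ++ d j ∷ z) (flatten-map blk d js)) (sym (++-assoc (blk j) (d j ∷ []) _))

  length≤length-flatten : ∀ D → length D ≤ length (flatten D)
  length≤length-flatten [] = z≤n
  length≤length-flatten ((b , c) ∷ D) = subst (suc (length D) ≤_) (sym (length-++ b))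
    (≤-trans (s≤s (length≤length-flatten D)) (m≤n+m _ (length b)))

  sortEach-layerBlocks : ∀ i blk js → sortEach (layerBlocks i blk js) ≡ concat (map (λ j → if i ≤ᵇ at α j then s (blk j) else []) js)
  sortEach-layerBlocks i blk [] = refl
  sortEach-layerBlocks i blk (j ∷ js) with i ≤ᵇ at α j
  ... | true = cong (s (blk j) ++_) (sortEach-layerBlocks i blk js)
  ... | false = sortEach-layerBlocks i blk js

  row-size : ∀ j → 1 ≤ j → j ≤ m → count (λ x → rowT x ≡ᵇ j) (oneTo n) ≡ at α j
  row-size j lo hi = begin
    count inRow (oneTo n)            ≡⟨ count≡length-filterᵇ inRow (oneTo n) ⟩
    length S                         ≡⟨ sym (length-map colT S) ⟩
    length (map colT S)              ≡⟨ Unique-length-≡ (map colT S) (range 1 (at α j)) Unique-cols (Unique-range 1 (at α j)) cols⊆ ⊆cols ⟩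
    length (range 1 (at α j))        ≡⟨ length-range 1 (at α j) ⟩
    at α j ∎
    where
    open ≡-Reasoning
    inRow = λ x → rowT x ≡ᵇ j
    S = filterᵇ inRow (oneTo n)
    ∈-S⁻ : ∀ {x} → x ∈ S → Entry x × rowT x ≡ j
    ∈-S⁻ {x} x∈ with ∈-filter⁻ (T? ∘ inRow) {xs = oneTo n} x∈
    ... | x∈oneTo , inRow-x = ∈-oneTo⁻ x∈oneTo , ≡ᵇ⇒≡ (rowT x) j inRow-x
    Unique-cols : Unique (map colT S)
    Unique-cols = Unique-map⁺ colT S (filter⁺ (T? ∘ inRow) (subst Unique (sym (oneTo≡range n)) (Unique-range 1 n)))
      λ {x} {y} x∈ y∈ col≡ → T-injective x y (proj₁ (∈-S⁻ x∈)) (proj₁ (∈-S⁻ y∈))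
                               (cong₂ _,_ col≡ (trans (proj₂ (∈-S⁻ x∈)) (sym (proj₂ (∈-S⁻ y∈)))))
    cols⊆ : ∀ {t} → t ∈ map colT S → t ∈ range 1 (at α j)
    cols⊆ t∈ with ∈-map⁻ colT t∈
    ... | x , x∈ , refl = ∈-range (proj₁ x∈D) (s≤s (subst (λ r → colT x ≤ at α r) (proj₂ (∈-S⁻ x∈)) (proj₂ (proj₂ (proj₂ x∈D)))))
      where x∈D = T∈D x (proj₁ (∈-S⁻ x∈))
    ⊆cols : ∀ {t} → t ∈ range 1 (at α j) → t ∈ map colT S
    ⊆cols {t} t∈ with T-surjective (t , j) (lower-bound-range t∈ , lo , hi , ≤-pred (upper-bound-range t∈))
    ... | x , x∈ , Tx≡ = subst (_∈ map colT S) (cong proj₁ Tx≡)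
           (∈-map⁺ colT (∈-filter⁺ (T? ∘ inRow) (∈-oneTo (proj₁ x∈) (proj₂ x∈)) (≡⇒≡ᵇ (rowT x) j (cong proj₂ Tx≡))))

  RowDecomposition : Set
  RowDecomposition = Σ (ℕ → List ℕ) λ B → ρ ≡ concat (map (λ j → B j ++ T⁻¹ 1 j ∷ []) rows)

  module Decomposition (B : ℕ → List ℕ) (ρ≡ : ρ ≡ concat (map (λ j → B j ++ T⁻¹ 1 j ∷ []) rows)) where

    segment : ℕ → List ℕ
    segment j = B j ++ T⁻¹ 1 j ∷ []

    Unique-segments : Unique (concat (map segment rows))
    Unique-segments = subst Unique ρ≡ Unique-ρ

    segment-index-unique : ∀ {y t t′} → 1 ≤ t → t ≤ m → 1 ≤ t′ → t′ ≤ m → y ∈ segment t → y ∈ segment t′ → t ≡ t′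
    segment-index-unique lo hi lo′ hi′ = Unique-concat-range⇒index-unique segment 1 m Unique-segments lo (s≤s hi) lo′ (s≤s hi′)

    segFrom : ℕ → ℕ → ℕ → ℕ
    segFrom a zero y = 0
    segFrom a (suc k) y with y ∈? segment a
    ... | yes _ = a
    ... | no _ = segFrom (suc a) k y

    -- The index of the segment of ρ containing y (0 if there is none).
    seg : ℕ → ℕ
    seg = segFrom 1 m

    segFrom-spec : ∀ a k {y t} → Unique (concat (map segment (range a k))) → a ≤ t → t < a + k → y ∈ segment t → segFrom a k y ≡ t
    segFrom-spec a zero u lo hi _ = ⊥-elim (<⇒≱ hi (subst (_≤ _) (sym (+-identityʳ a)) lo))
    segFrom-spec a (suc k) {y} {t} u lo hi y∈ with y ∈? segment a
    ... | yes y∈a = Unique-concat-range⇒index-unique segment a (suc k) u ≤-refl (a<a+suc a k) lo hi y∈a y∈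
    ... | no y∉a with m≤n⇒m<n∨m≡n lo
    ...   | inj₂ refl = ⊥-elim (y∉a y∈)
    ...   | inj₁ a<t = segFrom-spec (suc a) k (Unique-++⁻ʳ (segment a) u) a<t (subst (t <_) (+-suc a k) hi) y∈

    seg-spec : ∀ {y t} → 1 ≤ t → t ≤ m → y ∈ segment t → seg y ≡ t
    seg-spec lo hi = segFrom-spec 1 m Unique-segments lo (s≤s hi)

    seg-∈ : ∀ {y} → y ∈ ρ → 1 ≤ seg y × seg y ≤ m × y ∈ segment (seg y)
    seg-∈ y∈ with ∈-concat-range⁻ segment 1 m (subst (_ ∈_) ρ≡ y∈)
    ... | t , lo , hi , y∈t rewrite seg-spec lo (≤-pred hi) y∈t = lo , ≤-pred hi , y∈t

    segmentsBefore : ℕ → List ℕ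
    segmentsBefore r = concat (map segment (range 1 (r ∸ 1)))

    segments-split : ∀ r k → 1 ≤ r → r ≤ k →
      concat (map segment (range 1 k)) ≡ (segmentsBefore r ++ B r) ++ T⁻¹ 1 r ∷ concat (map segment (range (suc r) (k ∸ r)))
    segments-split (suc r) k _ r<k = begin
      concat (map segment (range 1 k))
        ≡⟨ cong (λ z → concat (map segment (range 1 z))) (sym (trans (+-suc r (k ∸ suc r)) (m+[n∸m]≡n r<k))) ⟩
      concat (map segment (range 1 (r + suc (k ∸ suc r))))
        ≡⟨ cong (concat ∘ map segment) (range-++ 1 r (suc (k ∸ suc r))) ⟩
      concat (map segment (range 1 r ++ range (suc r) (suc (k ∸ suc r))))
        ≡⟨ cong concat (map-++ segment (range 1 r) _) ⟩
      concat (map segment (range 1 r) ++ map segment (range (suc r) (suc (k ∸ suc r))))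
        ≡⟨ sym (concat-++ (map segment (range 1 r)) _) ⟩
      segmentsBefore (suc r) ++ (segment (suc r) ++ rest)
        ≡⟨ cong (segmentsBefore (suc r) ++_) (++-assoc (B (suc r)) (T⁻¹ 1 (suc r) ∷ []) rest) ⟩
      segmentsBefore (suc r) ++ (B (suc r) ++ T⁻¹ 1 (suc r) ∷ rest)
        ≡⟨ sym (++-assoc (segmentsBefore (suc r)) (B (suc r)) _) ⟩
      (segmentsBefore (suc r) ++ B (suc r)) ++ T⁻¹ 1 (suc r) ∷ rest ∎
      where
      open ≡-Reasoning
      rest = concat (map segment (range (suc (suc r)) (k ∸ suc r)))

    Unique-segments-prefix : ∀ k → k ≤ m → Unique (concat (map segment (range 1 k)))
    Unique-segments-prefix k k≤m = Unique-++⁻ˡ (concat (map segment (range 1 k))) (subst Unique all≡ Unique-segments)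
      where
      all≡ : concat (map segment rows) ≡ concat (map segment (range 1 k)) ++ concat (map segment (range (1 + k) (m ∸ k)))
      all≡ = trans (cong (concat ∘ map segment) (trans (cong (range 1) (sym (m+[n∸m]≡n k≤m))) (range-++ 1 k (m ∸ k))))
                   (trans (cong concat (map-++ segment (range 1 k) _)) (sym (concat-++ (map segment (range 1 k)) _)))

    throughIncl-T⁻¹ : ∀ j → 1 ≤ j → j ≤ m → throughIncl (T⁻¹ 1 j) π ≡ concat (map segment (range 1 j))
    throughIncl-T⁻¹ j lo hi = begin
      throughIncl (T⁻¹ 1 j) π
        ≡⟨ cong (throughIncl (T⁻¹ 1 j)) π-split ⟩
      throughIncl (T⁻¹ 1 j) ((segmentsBefore j ++ B j) ++ T⁻¹ 1 j ∷ (after ++ 0 ∷ []))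
        ≡⟨ throughIncl-++ (T⁻¹ 1 j) (segmentsBefore j ++ B j) _ (Unique-middle∉ˡ _ (subst Unique π-split Unique-π)) ⟩
      (segmentsBefore j ++ B j) ++ T⁻¹ 1 j ∷ []
        ≡⟨ cong (λ z → (segmentsBefore j ++ B j) ++ T⁻¹ 1 j ∷ concat (map segment (range (suc j) z))) (sym (n∸n≡0 j)) ⟩
      (segmentsBefore j ++ B j) ++ T⁻¹ 1 j ∷ concat (map segment (range (suc j) (j ∸ j)))
        ≡⟨ sym (segments-split j j lo ≤-refl) ⟩
      concat (map segment (range 1 j)) ∎
      where
      open ≡-Reasoning
      after = concat (map segment (range (suc j) (m ∸ j)))
      π-split : π ≡ (segmentsBefore j ++ B j) ++ T⁻¹ 1 j ∷ (after ++ 0 ∷ [])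
      π-split = trans π≡ (trans (cong (_++ 0 ∷ []) (trans ρ≡ (segments-split j m lo hi)))
                  (++-assoc (segmentsBefore j ++ B j) (T⁻¹ 1 j ∷ after) (0 ∷ [])))

    strictlyAfter-T⁻¹ : ∀ r j → 1 ≤ r → r < j → j ≤ m →
      strictlyAfter (T⁻¹ 1 r) (concat (map segment (range 1 j))) ≡ concat (map segment (range (suc r) (j ∸ r)))
    strictlyAfter-T⁻¹ r j lo r<j hi = trans (cong (strictlyAfter (T⁻¹ 1 r)) split)
      (strictlyAfter-++ (T⁻¹ 1 r) (segmentsBefore r ++ B r) _ (Unique-middle∉ˡ _ (subst Unique split (Unique-segments-prefix j hi))))
      where split = segments-split r j lo (<⇒≤ r<j)

    -- With seg y ≤ j, Beyond (i ∸ 1) j y says that y ∈ B_{π,T}(i,j,1) (∈-Bblock⁻ / ∈-Bblock⁺).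
    Beyond : ℕ → ℕ → ℕ → Set
    Beyond i j y = ∀ j′ → 1 ≤ j′ → j′ < j → i ≤ at α j′ → j′ < seg y

    Beyond-weaken : ∀ {i i′ j y} → i ≤ i′ → Beyond i j y → Beyond i′ j y
    Beyond-weaken i≤i′ beyond j′ lo j′<j i′≤ = beyond j′ lo j′<j (≤-trans i≤i′ i′≤)

    rIdx<j : ∀ i j → 1 ≤ j → rIdx α i j < j
    rIdx<j i (suc j) _ = s≤s (lastBelow-≤ j _)

    Bblock≡segments : ∀ i j → 1 ≤ j → j ≤ m → Bblock n α T π i j ≡ concat (map segment (range (suc (rIdx α i j)) (j ∸ rIdx α i j)))
    Bblock≡segments i j lo hi with rIdx α i j | rIdx<j i j lo
    ... | zero | _ = throughIncl-T⁻¹ j lo hi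
    ... | suc r | r<j = trans (cong (strictlyAfter (T⁻¹ 1 (suc r))) (throughIncl-T⁻¹ j lo hi)) (strictlyAfter-T⁻¹ (suc r) j (s≤s z≤n) r<j hi)

    rIdx<seg⇒Beyond : ∀ i j y → rIdx α i j < seg y → Beyond (i ∸ 1) j y
    rIdx<seg⇒Beyond i (suc j) y r<seg j′ lo j′<j i≤ =
      <-≤-trans (s≤s (≤-lastBelow j _ j′ lo (≤-pred j′<j) (≤⇒≤ᵇ≡true i≤))) r<seg

    Beyond⇒rIdx<seg : ∀ i j y → 1 ≤ seg y → Beyond (i ∸ 1) j y → rIdx α i j < seg y
    Beyond⇒rIdx<seg i zero y 1≤seg _ = 1≤seg
    Beyond⇒rIdx<seg i (suc j) y 1≤seg beyond with rIdx α i (suc j) in r≡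
    ... | zero = 1≤seg
    ... | suc r = beyond (suc r) (s≤s z≤n) (subst (_< suc j) r≡ (s≤s (lastBelow-≤ j _))) (≤ᵇ≡true⇒≤ (lastBelow-holds j _ r r≡))

    segments-end : ∀ i j → 1 ≤ j → suc (rIdx α i j) + (j ∸ rIdx α i j) ≡ suc j
    segments-end i j lo = cong suc (m+[n∸m]≡n (<⇒≤ (rIdx<j i j lo)))

    ∈-Bblock⁻ : ∀ i j x → 1 ≤ j → j ≤ m → x ∈ Bblock n α T π i j → seg x ≤ j × Beyond (i ∸ 1) j x
    ∈-Bblock⁻ i j x lo hi x∈ with ∈-concat-range⁻ segment _ _ (subst (x ∈_) (Bblock≡segments i j lo hi) x∈)
    ... | t , r<t , t<end , x∈t = subst (_≤ j) (sym seg≡t) t≤j , rIdx<seg⇒Beyond i j x (subst (rIdx α i j <_) (sym seg≡t) r<t)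
      where
      t≤j : t ≤ j
      t≤j = ≤-pred (subst (t <_) (segments-end i j lo) t<end)
      seg≡t : seg x ≡ t
      seg≡t = seg-spec (≤-trans (s≤s z≤n) r<t) (≤-trans t≤j hi) x∈t

    ∈-Bblock⁺ : ∀ i j x → Entry x → 1 ≤ j → j ≤ m → seg x ≤ j → Beyond (i ∸ 1) j x → x ∈ Bblock n α T π i j
    ∈-Bblock⁺ i j x x∈ lo hi seg≤j beyond with seg-∈ (Entry⇒∈-ρ x∈)
    ... | 1≤seg , _ , x∈seg = subst (x ∈_) (sym (Bblock≡segments i j lo hi))
      (∈-concat-range⁺ segment _ _ (Beyond⇒rIdx<seg i j x 1≤seg beyond) (subst (seg x <_) (sym (segments-end i j lo)) (s≤s seg≤j)) x∈seg)

    InBlock : ℕ → ℕ → ℕ → Set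
    InBlock i j y = Entry y × i < colT y × seg y ≤ j × Beyond i j y

    record Invariant (i : ℕ) (blk : ℕ → List ℕ) : Set where
      field
        left≡ : left i ≡ flatten (layerBlocks i blk rows)
        inBlock : ∀ j → InD α (i , j) → ∀ {y} → y ∈ blk j → InBlock i j y
        complete : ∀ y → Entry y → i ≤ colT y → y ∈ left i

    invariant₁ : Invariant 1 B
    invariant₁ = record { left≡ = left≡ ; inBlock = inBlock ; complete = λ y y∈ _ → subst (y ∈_) (sym left1≡ρ) (Entry⇒∈-ρ y∈) }
      where
      left≡ : left 1 ≡ flatten (layerBlocks 1 B rows)
      left≡ = trans left1≡ρ (trans ρ≡ (trans (sym (flatten-map B (T⁻¹ 1) rows)) (cong flatten (sym (firstLayerBlocks B)))))
      inBlock : ∀ j → InD α (1 , j) → ∀ {y} → y ∈ B j → InBlock 1 j y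
      inBlock j (_ , lo , hi , _) {y} y∈B = y∈ , 1<colT , ≤-reflexive seg≡j , λ j′ _ j′<j _ → subst (j′ <_) (sym seg≡j) j′<j
        where
        y∈seg : y ∈ segment j
        y∈seg = ∈-++⁺ˡ y∈B
        y∈ : Entry y
        y∈ = ∈-left⇒Entry 0 (subst (y ∈_) (sym (trans left1≡ρ ρ≡)) (∈-concat-range⁺ segment 1 m lo (s≤s hi) y∈seg))
        seg≡j : seg y ≡ j
        seg≡j = seg-spec lo hi y∈seg
        1<colT : 1 < colT y
        1<colT with m≤n⇒m<n∨m≡n (proj₁ (T∈D y y∈))
        ... | inj₁ 1<c = 1<c
        ... | inj₂ 1≡c = ⊥-elim (Unique-middle∉ˡ (B j) (Unique-concat-range⁻ segment 1 m Unique-segments lo (s≤s hi)) (subst (_∈ B j) y≡ y∈B))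
          where
          T⁻¹≡y : T⁻¹ 1 (rowT y) ≡ y
          T⁻¹≡y = T⁻¹-at-col y∈ (sym 1≡c)
          rowT≡j : rowT y ≡ j
          rowT≡j = segment-index-unique (proj₁ (proj₂ (T∈D y y∈))) (proj₁ (proj₂ (proj₂ (T∈D y y∈)))) lo hi
                     (∈-++⁺ʳ (B (rowT y)) (here (sym T⁻¹≡y))) y∈seg
          y≡ : y ≡ T⁻¹ 1 j
          y≡ = trans (sym T⁻¹≡y) (cong (T⁻¹ 1) rowT≡j)

    layer≡layerBlocks : ∀ k blk → Invariant (suc k) blk → Decreasing (layerBlocks (suc k) blk rows) →
      layer π (suc k) ≡ layerBlocks (suc k) blk rows
    layer≡layerBlocks k blk I decr = trans (cong (chain (length (iter k π))) (Invariant.left≡ I))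
      (chain-flatten _ _ decr (≤-trans (length≤length-flatten (layerBlocks (suc k) blk rows)) (subst (_≤ length (iter k π)) (cong length (Invariant.left≡ I)) (length-left k))))

    module Layer (k : ℕ) (blk : ℕ → List ℕ) (I : Invariant (suc k) blk) where
      open Invariant I

      ∈-left⁻ : ∀ {y} → y ∈ left (suc k) → Σ ℕ λ j → InD α (suc k , j) × (y ∈ blk j ⊎ y ≡ T⁻¹ (suc k) j)
      ∈-left⁻ y∈ with ∈-flatten-layerBlocks⁻ (suc k) blk rows (subst (_ ∈_) left≡ y∈)
      ... | j , j∈ , reach , y∈j = j , (s≤s z≤n , row-lower j∈ , row-upper j∈ , reach) , y∈j

      Unique-layer : Unique (concat (map (blockOrEmpty (suc k) blk) rows))
      Unique-layer = subst Unique (trans left≡ (flatten-layerBlocks (suc k) blk rows)) (Unique-left k)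

      ∈-blockOrEmpty : ∀ {j y} → suc k ≤ at α j → y ∈ blk j → y ∈ blockOrEmpty (suc k) blk j
      ∈-blockOrEmpty reach y∈ rewrite ≤⇒≤ᵇ≡true reach = ∈-++⁺ˡ y∈

      blocks-disjoint : ∀ {j j′ y} → InD α (suc k , j) → InD α (suc k , j′) → y ∈ blk j → y ∈ blk j′ → j ≡ j′
      blocks-disjoint (_ , lo , hi , reach) (_ , lo′ , hi′ , reach′) y∈ y∈′ =
        Unique-concat-range⇒index-unique (blockOrEmpty (suc k) blk) 1 m Unique-layer lo (s≤s hi) lo′ (s≤s hi′)
          (∈-blockOrEmpty reach y∈) (∈-blockOrEmpty reach′ y∈′)

      Unique-block : ∀ {j} → InD α (suc k , j) → Unique (blk j)
      Unique-block {j} (_ , lo , hi , reach) = Unique-++⁻ˡ (blk j)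
        (subst Unique (cong (λ b → if b then blk j ++ T⁻¹ (suc k) j ∷ [] else []) (≤⇒≤ᵇ≡true reach))
          (Unique-concat-range⁻ (blockOrEmpty (suc k) blk) 1 m Unique-layer lo (s≤s hi)))

      flatten-positive : All (0 <_) (flatten (layerBlocks (suc k) blk rows))
      flatten-positive = All.tabulate (λ y∈ → proj₁ (∈-left⇒Entry k (subst (_ ∈_) (sym left≡) y∈)))

      left-next : Decreasing (layerBlocks (suc k) blk rows) → left (suc (suc k)) ≡ sortEach (layerBlocks (suc k) blk rows)
      left-next decr with iter≡left++0 k
      ... | τ , eq , 0∉ with s-blocks (layerBlocks (suc k) blk rows) τ decr flatten-positive
      ...   | W , s≡ = trans (cong (λ z → proj₁ (cut 0 z)) iter≡) (cong proj₁ (cut-++ 0 _ W 0∉sorted))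
        where
        D = layerBlocks (suc k) blk rows
        iter≡ : iter (suc k) π ≡ sortEach D ++ 0 ∷ W
        iter≡ = trans (iter-suc k π) (trans (cong s (trans eq (cong (λ z → z ++ 0 ∷ τ) left≡))) s≡)
        0∉sorted : 0 ∉ sortEach D
        0∉sorted 0∈ = 0∉ (subst (0 ∈_) (sym left≡) (∈-sortEach⁻ D 0∈))

      MaxInBlocks : Set
      MaxInBlocks = ∀ j → InD α (suc (suc k) , j) → T⁻¹ (suc (suc k)) j ∈ blk j × All (_≤ T⁻¹ (suc (suc k)) j) (blk j)

      module Step (maxIn : MaxInBlocks) (decr : Decreasing (layerBlocks (suc k) blk rows)) where

        i⁺ : ℕ
        i⁺ = suc (suc k)


        next-column-entry : ∀ {j y} → InD α (suc k , j) → y ∈ blk j → colT y ≡ i⁺ → i⁺ ≤ at α j × y ≡ T⁻¹ i⁺ j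
        next-column-entry {j} {y} j∈D y∈ colT≡ = subst (λ r → i⁺ ≤ at α r) rowT≡j reach , trans (sym T⁻¹≡y) (cong (T⁻¹ i⁺) rowT≡j)
          where
          y∈D = T∈D y (proj₁ (Invariant.inBlock I j j∈D y∈))
          reach : i⁺ ≤ at α (rowT y)
          reach = subst (_≤ at α (rowT y)) colT≡ (proj₂ (proj₂ (proj₂ y∈D)))
          r∈D : InD α (i⁺ , rowT y)
          r∈D = s≤s z≤n , proj₁ (proj₂ y∈D) , proj₁ (proj₂ (proj₂ y∈D)) , reach
          T⁻¹≡y : T⁻¹ i⁺ (rowT y) ≡ y
          T⁻¹≡y = T⁻¹-at-col (proj₁ (Invariant.inBlock I j j∈D y∈)) colT≡
          rowT≡j : rowT y ≡ j
          rowT≡j = blocks-disjoint (weaken-column r∈D) j∈D (subst (_∈ blk (rowT y)) T⁻¹≡y (proj₁ (maxIn (rowT y) r∈D))) y∈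

        sortedBlock : ℕ → List ℕ
        sortedBlock j = if suc k ≤ᵇ at α j then s (blk j) else []

        sortedBlock-reaching : ∀ {a} → suc k ≤ at α a → sortedBlock a ≡ s (blk a)
        sortedBlock-reaching reach rewrite ≤⇒≤ᵇ≡true reach = refl

        sortedBlock-short : ∀ {a} → at α a < suc k → sortedBlock a ≡ []
        sortedBlock-short short rewrite >⇒≤ᵇ≡false short = refl

        Beyond-extend : ∀ {a y} → at α a < i⁺ → Beyond i⁺ a y → Beyond i⁺ (suc a) y
        Beyond-extend short beyond j′ lo j′≤a reach with m≤n⇒m<n∨m≡n (≤-pred j′≤a)
        ... | inj₁ j′<a = beyond j′ lo j′<a reach
        ... | inj₂ refl = ⊥-elim (<⇒≱ short reach)

        -- y still has to be placed, in the block of a row ≥ a of layer i⁺.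
        Pending : ℕ → ℕ → Set
        Pending a y = Entry y × i⁺ < colT y × seg y < a × Beyond i⁺ a y

        Pending-advance : ∀ {a y} → at α a < i⁺ → Pending a y → Pending (suc a) y
        Pending-advance short (y∈ , col< , seg< , beyond) = y∈ , col< , ≤-trans seg< (n≤1+n _) , Beyond-extend short beyond

        Pending-carry : ∀ {a y} → InD α (suc k , a) → at α a < i⁺ → y ∈ s (blk a) → Pending (suc a) y
        Pending-carry {a} a∈D short y∈s with Invariant.inBlock I a a∈D (∈-resp-↭ (s-↭ (blk a)) y∈s)
        ... | y∈ , col< , seg≤ , beyond =
          y∈ , ≤∧≢⇒< col< (λ i⁺≡ → <⇒≱ short (proj₁ (next-column-entry a∈D (∈-resp-↭ (s-↭ (blk a)) y∈s) (sym i⁺≡)))) ,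
          s≤s seg≤ , Beyond-extend short (Beyond-weaken (n≤1+n _) beyond)

        record Regrouped (a kk : ℕ) (acc : List ℕ) : Set where
          field
            blk′ : ℕ → List ℕ
            pending : List ℕ
            regroup≡ : acc ++ concat (map sortedBlock (range a kk)) ≡ flatten (layerBlocks i⁺ blk′ (range a kk)) ++ pending
            inBlock′ : ∀ j → a ≤ j → j < a + kk → InD α (i⁺ , j) → ∀ {y} → y ∈ blk′ j → InBlock i⁺ j y
            pending-ok : ∀ {y} → y ∈ pending → Pending (a + kk) y

        regroup-done : ∀ a acc → (∀ {y} → y ∈ acc → Pending a y) → Regrouped a 0 acc
        regroup-done a acc acc-ok = record
          { blk′ = λ _ → [] ; pending = acc ; regroup≡ = ++-identityʳ acc
          ; inBlock′ = λ j a≤j j< _ → ⊥-elim (<⇒≱ j< (subst (_≤ j) (sym (+-identityʳ a)) a≤j))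
          ; pending-ok = λ {y} y∈ → subst (λ b → Pending b y) (sym (+-identityʳ a)) (acc-ok y∈) }

        sortedBlock-split : ∀ {a} → InD α (i⁺ , a) → Σ (List ℕ) λ A → s (blk a) ≡ A ++ T⁻¹ i⁺ a ∷ [] × T⁻¹ i⁺ a ∉ A
        sortedBlock-split {a} a∈D with s-ends-with-max (blk a) (proj₁ (maxIn a a∈D)) (proj₂ (maxIn a a∈D)) (Unique-block (weaken-column a∈D))
        ... | A , s≡ = A , s≡ ,
          Unique-middle∉ˡ A (subst Unique s≡ (Unique-resp-↭ (setoid ℕ) (↭⇒↭ₛ (↭-sym (s-↭ (blk a)))) (Unique-block (weaken-column a∈D))))

        -- Rows of length < i⁺ have no block in layer i⁺: their sorted blocks are carried
        -- over to the next row that does.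
        regroup-pass : ∀ a kk acc acc′ → at α a < i⁺ → acc ++ sortedBlock a ≡ acc′ →
          Regrouped (suc a) kk acc′ → Regrouped a (suc kk) acc
        regroup-pass a kk acc acc′ short acc≡ R = record
          { blk′ = blk′ ; pending = pending
          ; regroup≡ = trans (sym (++-assoc acc (sortedBlock a) rest))
                        (trans (cong (_++ rest) acc≡) (trans regroup≡ (cong (λ D → flatten D ++ pending) (sym (layerBlocks-short i⁺ blk′ a (range (suc a) kk) short)))))
          ; inBlock′ = inBlock″
          ; pending-ok = λ {y} y∈ → subst (λ b → Pending b y) (sym (+-suc a kk)) (pending-ok y∈) }
          where
          open Regrouped R
          rest = concat (map sortedBlock (range (suc a) kk))
          inBlock″ : ∀ j → a ≤ j → j < a + suc kk → InD α (i⁺ , j) → ∀ {y} → y ∈ blk′ j → InBlock i⁺ j y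
          inBlock″ j a≤j j< j∈D with m≤n⇒m<n∨m≡n a≤j
          ... | inj₁ a<j = inBlock′ j a<j (subst (j <_) (+-suc a kk) j<) j∈D
          ... | inj₂ refl = ⊥-elim (<⇒≱ short (proj₂ (proj₂ (proj₂ j∈D))))

        regroup-close : ∀ a kk acc → InD α (i⁺ , a) → (∀ {y} → y ∈ acc → Pending a y) →
          Regrouped (suc a) kk [] → Regrouped a (suc kk) acc
        regroup-close a kk acc a∈D acc-ok R = record
          { blk′ = blk⁺ ; pending = pending ; regroup≡ = regroup≡′ ; inBlock′ = inBlock″
          ; pending-ok = λ {y} y∈ → subst (λ b → Pending b y) (sym (+-suc a kk)) (pending-ok y∈) }
          where
          open Regrouped R
          c = T⁻¹ i⁺ a
          a∈D′ = weaken-column a∈D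
          A = proj₁ (sortedBlock-split a∈D)
          s≡ = proj₁ (proj₂ (sortedBlock-split a∈D))
          c∉A = proj₂ (proj₂ (sortedBlock-split a∈D))
          blk⁺ = update blk′ a (acc ++ A)
          later = layerBlocks i⁺ blk⁺ (range (suc a) kk)
          later≡ : later ≡ layerBlocks i⁺ blk′ (range (suc a) kk)
          later≡ = layerBlocks-cong i⁺ blk⁺ blk′ (range (suc a) kk) (λ j∈ → update-other blk′ a (acc ++ A) _ (lower-bound-range j∈))
          regroup≡′ : acc ++ concat (map sortedBlock (range a (suc kk))) ≡ flatten (layerBlocks i⁺ blk⁺ (range a (suc kk))) ++ pending
          regroup≡′ = begin
            acc ++ (sortedBlock a ++ R′)          ≡⟨ cong (λ z → acc ++ (z ++ R′)) (trans (sortedBlock-reaching (proj₂ (proj₂ (proj₂ a∈D′)))) s≡) ⟩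
            acc ++ ((A ++ c ∷ []) ++ R′)          ≡⟨ cong (acc ++_) (++-assoc A (c ∷ []) R′) ⟩
            acc ++ (A ++ c ∷ R′)                  ≡⟨ sym (++-assoc acc A (c ∷ R′)) ⟩
            (acc ++ A) ++ c ∷ R′                  ≡⟨ cong (λ z → (acc ++ A) ++ c ∷ z) regroup≡ ⟩
            (acc ++ A) ++ c ∷ (flatten (layerBlocks i⁺ blk′ (range (suc a) kk)) ++ pending)
              ≡⟨ cong₂ (λ u v → u ++ c ∷ (flatten v ++ pending)) (sym (update-same blk′ a (acc ++ A))) (sym later≡) ⟩
            blk⁺ a ++ c ∷ (flatten later ++ pending) ≡⟨ sym (++-assoc (blk⁺ a) (c ∷ flatten later) pending) ⟩
            flatten ((blk⁺ a , c) ∷ later) ++ pending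
              ≡⟨ cong (λ D → flatten D ++ pending) (sym (layerBlocks-reaching i⁺ blk⁺ a (range (suc a) kk) (proj₂ (proj₂ (proj₂ a∈D))))) ⟩
            flatten (layerBlocks i⁺ blk⁺ (range a (suc kk))) ++ pending ∎
            where
            open ≡-Reasoning
            R′ = concat (map sortedBlock (range (suc a) kk))
          fromA : ∀ {y} → y ∈ A → InBlock i⁺ a y
          fromA {y} y∈A = promote (∈-resp-↭ (s-↭ (blk a)) (subst (y ∈_) (sym s≡) (∈-++⁺ˡ y∈A)))
            where
            promote : y ∈ blk a → InBlock i⁺ a y
            promote y∈blk with Invariant.inBlock I a a∈D′ y∈blk
            ... | y∈′ , col< , seg≤ , beyond =
              y∈′ , ≤∧≢⇒< col< (λ i⁺≡ → c∉A (subst (_∈ A) (proj₂ (next-column-entry a∈D′ y∈blk (sym i⁺≡))) y∈A)) , seg≤ ,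
              Beyond-weaken (n≤1+n _) beyond
          inBlock-here : ∀ {y} → y ∈ acc ++ A → InBlock i⁺ a y
          inBlock-here y∈ with ∈-++⁻ acc y∈
          ... | inj₁ y∈acc = let (y∈′ , col< , seg< , beyond) = acc-ok y∈acc in y∈′ , col< , <⇒≤ seg< , beyond
          ... | inj₂ y∈A = fromA y∈A
          inBlock″ : ∀ j → a ≤ j → j < a + suc kk → InD α (i⁺ , j) → ∀ {y} → y ∈ blk⁺ j → InBlock i⁺ j y
          inBlock″ j a≤j j< j∈D y∈ with m≤n⇒m<n∨m≡n a≤j
          ... | inj₁ a<j = inBlock′ j a<j (subst (j <_) (+-suc a kk) j<) j∈D (subst (_ ∈_) (update-other blk′ a (acc ++ A) j a<j) y∈)
          ... | inj₂ refl = inBlock-here (subst (_ ∈_) (update-same blk′ a (acc ++ A)) y∈)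

        regroup : ∀ a kk acc → 1 ≤ a → a + kk ≡ suc m → (∀ {y} → y ∈ acc → Pending a y) → Regrouped a kk acc
        regroup a zero acc _ _ acc-ok = regroup-done a acc acc-ok
        regroup a (suc kk) acc lo end acc-ok with <-cmp (at α a) (suc k)
        ... | tri< short _ _ =
          regroup-pass a kk acc acc short′ (trans (cong (acc ++_) (sortedBlock-short short)) (++-identityʳ acc))
            (regroup (suc a) kk acc (s≤s z≤n) end′ (Pending-advance short′ ∘ acc-ok))
          where short′ = ≤-trans short (n≤1+n _)
                end′ = trans (sym (+-suc a kk)) end
        ... | tri≈ _ α≡ _ =
          regroup-pass a kk acc (acc ++ s (blk a)) short (cong (acc ++_) (sortedBlock-reaching (≤-reflexive (sym α≡))))
            (regroup (suc a) kk (acc ++ s (blk a)) (s≤s z≤n) (trans (sym (+-suc a kk)) end) carried)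
          where
          short = s≤s (≤-reflexive α≡)
          a∈D′ : InD α (suc k , a)
          a∈D′ = s≤s z≤n , lo , ≤-pred (subst (a <_) end (a<a+suc a kk)) , ≤-reflexive (sym α≡)
          carried : ∀ {y} → y ∈ acc ++ s (blk a) → Pending (suc a) y
          carried y∈ with ∈-++⁻ acc y∈
          ... | inj₁ y∈acc = Pending-advance short (acc-ok y∈acc)
          ... | inj₂ y∈s = Pending-carry a∈D′ short y∈s
        ... | tri> _ _ long =
          regroup-close a kk acc (s≤s z≤n , lo , ≤-pred (subst (a <_) end (a<a+suc a kk)) , long) acc-ok
            (regroup (suc a) kk [] (s≤s z≤n) (trans (sym (+-suc a kk)) end) (λ ()))

        record NextLayer : Set where
          field
            blk⁺ : ℕ → List ℕ
            leftover : List ℕ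
            left≡⁺ : left i⁺ ≡ flatten (layerBlocks i⁺ blk⁺ rows) ++ leftover
            inBlock⁺ : ∀ j → InD α (i⁺ , j) → ∀ {y} → y ∈ blk⁺ j → InBlock i⁺ j y
            leftover-pending : ∀ {y} → y ∈ leftover → Pending (suc m) y
            complete⁺ : ∀ y → Entry y → i⁺ ≤ colT y → y ∈ left i⁺

          invariant⁺ : leftover ≡ [] → Invariant i⁺ blk⁺
          invariant⁺ leftover≡[] = record
            { left≡ = trans left≡⁺ (trans (cong (flatten (layerBlocks i⁺ blk⁺ rows) ++_) leftover≡[]) (++-identityʳ _))
            ; inBlock = inBlock⁺ ; complete = complete⁺ }

        next : NextLayer
        next = record
          { blk⁺ = blk′ ; leftover = pending
          ; left≡⁺ = trans (left-next decr) (trans (sortEach-layerBlocks (suc k) blk rows) regroup≡)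
          ; inBlock⁺ = λ j j∈D → inBlock′ j (proj₁ (proj₂ j∈D)) (s≤s (proj₁ (proj₂ (proj₂ j∈D)))) j∈D
          ; leftover-pending = pending-ok
          ; complete⁺ = complete⁺ }
          where
          open Regrouped (regroup 1 m [] ≤-refl refl (λ ()))
          complete⁺ : ∀ y → Entry y → i⁺ ≤ colT y → y ∈ left i⁺
          complete⁺ y y∈ i⁺≤ with ∈-left⁻ (Invariant.complete I y y∈ (≤-trans (n≤1+n _) i⁺≤))
          ... | j , j∈D , inj₂ refl = ⊥-elim (<-irrefl (sym (colT-T⁻¹ j∈D)) i⁺≤)
          ... | j , j∈D , inj₁ y∈blk = subst (y ∈_) (sym (left-next decr))
                 (∈-sortEach⁺ (layerBlocks (suc k) blk rows) (∈-layerBlocks⁺ (suc k) blk rows (∈-rows (proj₁ (proj₂ j∈D)) (proj₁ (proj₂ (proj₂ j∈D)))) (proj₂ (proj₂ (proj₂ j∈D)))) y∈blk)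

    module Backward (inBblock : ∀ y → Entry y → 2 ≤ colT y → seg y ≤ rowT y × Beyond (colT y ∸ 1) (rowT y) y) where

      module BlocksOf (k : ℕ) (blk : ℕ → List ℕ) (I : Invariant (suc k) blk) where
        open Invariant I
        open Layer k blk I

        row-≥ : ∀ {j y} → InD α (suc k , j) → y ∈ blk j → j ≤ rowT y
        row-≥ {j} {y} j∈D y∈ with ≤-<-connex j (rowT y)
        ... | inj₁ j≤ = j≤
        ... | inj₂ rowT<j = ⊥-elim (<⇒≱ (beyond (rowT y) (proj₁ (proj₂ y∈D)) rowT<j (≤-trans (≤-trans (n≤1+n _) col>) (proj₂ (proj₂ (proj₂ y∈D)))))
                                         (proj₁ (inBblock y y∈′ (≤-trans (s≤s (s≤s z≤n)) col>))))
          where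
          entry = inBlock j j∈D y∈
          y∈′ = proj₁ entry
          col> = proj₁ (proj₂ entry)
          beyond = proj₂ (proj₂ (proj₂ entry))
          y∈D = T∈D y y∈′

        block<T⁻¹ : ∀ {j j′ y} → InD α (suc k , j) → InD α (suc k , j′) → y ∈ blk j′ → j ≤ j′ → y < T⁻¹ (suc k) j
        block<T⁻¹ {j} {j′} {y} j∈D j′∈D y∈ j≤j′ =
          ≤∧≢⇒< (T-monotone (T⁻¹ (suc k) j) y (Entry-T⁻¹ j∈D) y∈′
                   (subst (_≤ colT y) (sym (colT-T⁻¹ j∈D)) (≤-trans (n≤1+n _) col>))
                   (subst (_≤ rowT y) (sym (rowT-T⁻¹ j∈D)) (≤-trans j≤j′ (row-≥ j′∈D y∈))))
                (λ y≡ → <-irrefl (trans (sym (colT-T⁻¹ j∈D)) (cong colT (sym y≡))) col>)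
          where
          y∈′ = proj₁ (inBlock j′ j′∈D y∈)
          col> = proj₁ (proj₂ (inBlock j′ j′∈D y∈))

        T⁻¹-decreasing : ∀ {j j′} → InD α (suc k , j) → InD α (suc k , j′) → j < j′ → T⁻¹ (suc k) j′ < T⁻¹ (suc k) j
        T⁻¹-decreasing j∈D j′∈D j<j′ =
          ≤∧≢⇒< (T-monotone _ _ (Entry-T⁻¹ j∈D) (Entry-T⁻¹ j′∈D)
                   (≤-reflexive (trans (colT-T⁻¹ j∈D) (sym (colT-T⁻¹ j′∈D))))
                   (subst₂ _≤_ (sym (rowT-T⁻¹ j∈D)) (sym (rowT-T⁻¹ j′∈D)) (<⇒≤ j<j′)))
                (λ e → <-irrefl (trans (sym (rowT-T⁻¹ j∈D)) (trans (cong rowT (sym e)) (rowT-T⁻¹ j′∈D))) j<j′)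

        decreasingFrom : ∀ a kk → 1 ≤ a → a + kk ≡ suc m → Decreasing (layerBlocks (suc k) blk (range a kk))
        decreasingFrom a zero _ _ = []
        decreasingFrom a (suc kk) lo end with suc k ≤? at α a
        ... | no ¬reach = subst Decreasing (sym (layerBlocks-short (suc k) blk a (range (suc a) kk) (≰⇒> ¬reach)))
                            (decreasingFrom (suc a) kk (s≤s z≤n) end′)
          where end′ = trans (sym (+-suc a kk)) end
        ... | yes reach = subst Decreasing (sym (layerBlocks-reaching (suc k) blk a (range (suc a) kk) reach))
                            ((All.tabulate (λ y∈ → block<T⁻¹ a∈D a∈D y∈ ≤-refl) , All.tabulate later<) ∷
                             decreasingFrom (suc a) kk (s≤s z≤n) end′)
          where
          end′ = trans (sym (+-suc a kk)) end
          a∈D : InD α (suc k , a)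
          a∈D = s≤s z≤n , lo , ≤-pred (subst (a <_) end (a<a+suc a kk)) , reach
          j′∈D : ∀ {j′} → j′ ∈ range (suc a) kk → suc k ≤ at α j′ → InD α (suc k , j′)
          j′∈D {j′} j′∈ reach′ = s≤s z≤n , ≤-trans (s≤s z≤n) (lower-bound-range j′∈) , ≤-pred (subst (j′ <_) end′ (upper-bound-range j′∈)) , reach′
          later< : ∀ {y} → y ∈ flatten (layerBlocks (suc k) blk (range (suc a) kk)) → y < T⁻¹ (suc k) a
          later< y∈ with ∈-flatten-layerBlocks⁻ (suc k) blk (range (suc a) kk) y∈
          ... | j′ , j′∈ , reach′ , inj₁ y∈blk = block<T⁻¹ a∈D (j′∈D j′∈ reach′) y∈blk (<⇒≤ (lower-bound-range j′∈))
          ... | j′ , j′∈ , reach′ , inj₂ refl = T⁻¹-decreasing a∈D (j′∈D j′∈ reach′) (lower-bound-range j′∈)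

        decreasing : Decreasing (layerBlocks (suc k) blk rows)
        decreasing = decreasingFrom 1 m ≤-refl refl

        maxInBlocks : MaxInBlocks
        maxInBlocks j j∈D = x∈blk , All.tabulate y≤x
          where
          x = T⁻¹ (suc (suc k)) j
          j∈D′ : InD α (suc k , j)
          j∈D′ = weaken-column j∈D
          x∈ = Entry-T⁻¹ j∈D
          x-beyond : seg x ≤ rowT x × Beyond (colT x ∸ 1) (rowT x) x
          x-beyond = inBblock x x∈ (subst (2 ≤_) (sym (colT-T⁻¹ j∈D)) (s≤s (s≤s z≤n)))
          x∈blk : x ∈ blk j
          x∈blk with ∈-left⁻ (complete x x∈ (≤-trans (n≤1+n _) (≤-reflexive (sym (colT-T⁻¹ j∈D)))))
          ... | j′ , j′∈D , inj₂ x≡ = ⊥-elim (<-irrefl (trans (sym (colT-T⁻¹ j′∈D)) (trans (cong colT (sym x≡)) (colT-T⁻¹ j∈D))) ≤-refl)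
          ... | j′ , j′∈D , inj₁ x∈blk′ with <-cmp j′ j | inBlock j′ j′∈D x∈blk′
          ...   | tri≈ _ refl _ | _ = x∈blk′
          ...   | tri< j′<j _ _ | _ , _ , seg≤j′ , _ =
            ⊥-elim (<⇒≱ (proj₂ x-beyond j′ (proj₁ (proj₂ j′∈D)) (subst (j′ <_) (sym (rowT-T⁻¹ j∈D)) j′<j)
                            (subst (λ c → c ∸ 1 ≤ at α j′) (sym (colT-T⁻¹ j∈D)) (proj₂ (proj₂ (proj₂ j′∈D)))))
                        seg≤j′)
          ...   | tri> _ _ j<j′ | _ , _ , _ , beyond =
            ⊥-elim (<⇒≱ (beyond j (proj₁ (proj₂ j∈D)) j<j′ (proj₂ (proj₂ (proj₂ j∈D′))))
                        (subst (seg x ≤_) (rowT-T⁻¹ j∈D) (proj₁ x-beyond)))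
          y≤x : ∀ {y} → y ∈ blk j → y ≤ x
          y≤x {y} y∈ = T-monotone x y x∈ (proj₁ (inBlock j j∈D′ y∈))
                         (subst (_≤ colT y) (sym (colT-T⁻¹ j∈D)) (proj₁ (proj₂ (inBlock j j∈D′ y∈))))
                         (subst (_≤ rowT y) (sym (rowT-T⁻¹ j∈D)) (row-≥ j∈D′ y∈))

      -- The leftover of each step is empty: by (b), an entry would otherwise lie in a
      -- segment after its own row.
      layers : ∀ k → Σ (ℕ → List ℕ) (Invariant (suc k))
      layers zero = B , invariant₁
      layers (suc k) with layers k
      ... | blk , I = blk⁺ , invariant⁺ (empty-if-no-members leftover not-pending)
        where
        open BlocksOf k blk I
        open Layer.Step k blk I maxInBlocks decreasing using (NextLayer; next)
        open NextLayer next
        not-pending : ∀ {y} → y ∉ leftover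
        not-pending {y} y∈ with leftover-pending y∈
        ... | y∈′ , col> , _ , beyond =
          <⇒≱ (beyond (rowT y) (proj₁ (proj₂ y∈D)) (s≤s (proj₁ (proj₂ (proj₂ y∈D))))
                 (≤-trans (n≤1+n _) (≤-trans col> (proj₂ (proj₂ (proj₂ y∈D))))))
              (proj₁ (inBblock y y∈′ (≤-trans (s≤s (s≤s z≤n)) (≤-trans (n≤1+n _) col>))))
          where y∈D = T∈D y y∈′

      blocks : ℕ → ℕ → List ℕ
      blocks k = proj₁ (layers k)

      layer≡ : ∀ k → layer π (suc k) ≡ layerBlocks (suc k) (blocks k) rows
      layer≡ k = layer≡layerBlocks k (blocks k) (proj₂ (layers k)) (BlocksOf.decreasing k (blocks k) (proj₂ (layers k)))

      posIn-layer-other : ∀ x k → Entry x → suc k ≢ colT x → posIn x (layer π (suc k)) ≡ nothing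
      posIn-layer-other x k x∈ k≢ = trans (cong (posIn x) (layer≡ k)) (posIn-∉ x _ x∉)
        where
        x∉ : x ∉ keys (layerBlocks (suc k) (blocks k) rows)
        x∉ x∈keys with ∈-keys-layerBlocks⁻ (suc k) (blocks k) rows x∈keys
        ... | j , j∈ , reach , refl = k≢ (sym (colT-T⁻¹ (s≤s z≤n , row-lower j∈ , row-upper j∈ , reach)))

      posIn-layer-own : ∀ x k → Entry x → colT x ≡ suc k → Σ ℕ λ p → posIn x (layer π (suc k)) ≡ just p
      posIn-layer-own x k x∈ col≡ = let (p , eq) = posIn-∈ x _ x∈keys in p , trans (cong (posIn x) (layer≡ k)) eq
        where
        x∈D = T∈D x x∈
        x∈keys : x ∈ keys (layerBlocks (suc k) (blocks k) rows)
        x∈keys = subst (_∈ keys (layerBlocks (suc k) (blocks k) rows)) (T⁻¹-at-col x∈ col≡)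
                   (∈-keys-layerBlocks⁺ (suc k) (blocks k) rows (∈-rows (proj₁ (proj₂ x∈D)) (proj₁ (proj₂ (proj₂ x∈D))))
                     (subst (_≤ at α (rowT x)) col≡ (proj₂ (proj₂ (proj₂ x∈D)))))

      colT≤sc : ∀ x → Entry x → colT x ≤ sc π
      colT≤sc x x∈ = scAux-≥ (colT x) (length π) π col≤ not-increasing
        where
        x∈D = T∈D x x∈
        col≤ : colT x ≤ length π
        col≤ = subst (colT x ≤_) (sym (length-iter 0))
                 (≤-trans (≤-trans (proj₂ (proj₂ (proj₂ x∈D))) (subst (at α (rowT x) ≤_) (proj₂ comp) (at-≤-sum α (rowT x)))) (n≤1+n n))
        not-increasing : ∀ k → k < colT x → increasing (iter k π) ≡ false
        not-increasing k k<col = increasing-iter-false k (Invariant.complete (proj₂ (layers k)) x x∈ k<col)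

      coord≡ : ∀ x → Entry x → Σ ℕ λ p → coord π x ≡ just (colT x , p)
      coord≡ x x∈ with colT-positive x x∈
      ... | k , col≡ with posIn-layer-own x k x∈ col≡
      ...   | p , eq = p , firstJust-unique (oneTo (sc π)) (λ i → posIn x (layer π i))
                (∈-oneTo (proj₁ (T∈D x x∈)) (colT≤sc x x∈)) (subst (λ c → posIn x (layer π c) ≡ just p) (sym col≡) eq) others
        where
        others : ∀ i → i ∈ oneTo (sc π) → i ≢ colT x → posIn x (layer π i) ≡ nothing
        others zero i∈ _ = ⊥-elim (<⇒≱ (lower-bound-range (subst (0 ∈_) (oneTo≡range (sc π)) i∈)) z≤n)
        others (suc i) _ i≢ = posIn-layer-other x i x∈ i≢

      owner-T⁻¹ : ∀ k j → InD α (suc (suc k) , j) → owner (T⁻¹ (suc (suc k)) j) (layer π (suc k)) ≡ just (T⁻¹ (suc k) j)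
      owner-T⁻¹ k j j∈D = trans (cong (owner x) (layer≡ k))
        (owner-complete x (layerBlocks (suc k) (blocks k) rows)
          (subst (λ b → (b , T⁻¹ (suc k) j) ∈ layerBlocks (suc k) (blocks k) rows) (proj₁ (proj₂ (proj₂ max)))
            (∈-layerBlocks⁺ (suc k) (blocks k) rows (∈-rows (proj₁ (proj₂ j∈D)) (proj₁ (proj₂ (proj₂ j∈D)))) (proj₂ (proj₂ (proj₂ j∈D′)))))
          (proj₂ (proj₂ (proj₂ max))) only)
        where
        open BlocksOf k (blocks k) (proj₂ (layers k)) using (maxInBlocks)
        open Layer k (blocks k) (proj₂ (layers k)) using (blocks-disjoint)
        x = T⁻¹ (suc (suc k)) j
        j∈D′ = weaken-column j∈D
        max = max-of-list (blocks k j) (proj₁ (maxInBlocks j j∈D)) (proj₂ (maxInBlocks j j∈D))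
        only : ∀ {b c} → (b , c) ∈ layerBlocks (suc k) (blocks k) rows → x ∈ b → c ≡ T⁻¹ (suc k) j
        only e∈ x∈b with ∈-layerBlocks⁻ (suc k) (blocks k) rows e∈
        ... | j′ , j′∈ , reach , refl , refl =
          cong (T⁻¹ (suc k)) (blocks-disjoint (s≤s z≤n , row-lower j′∈ , row-upper j′∈ , reach) j∈D′ x∈b (proj₁ (maxInBlocks j j∈D)))

      rowAux≡ : ∀ k x → Entry x → colT x ≡ suc k → rowAux π (suc k) x ≡ just (rowT x)
      rowAux≡ zero x x∈ col≡ = begin
        posIn x (layer π 1)                                    ≡⟨ cong (posIn x) (trans (layer≡ 0) (firstLayerBlocks B)) ⟩
        posIn x (map (λ j → (B j , T⁻¹ 1 j)) rows)             ≡⟨ cong (λ z → posIn z (map (λ j → (B j , T⁻¹ 1 j)) rows)) (sym (T⁻¹-at-col x∈ col≡)) ⟩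
        posIn (T⁻¹ 1 (rowT x)) (map (λ j → (B j , T⁻¹ 1 j)) rows) ≡⟨ posIn-map-range (T⁻¹ 1) B 1 m (rowT x) T⁻¹-injective lo (s≤s hi) ⟩
        just (suc (rowT x ∸ 1))                                ≡⟨ cong just (m+[n∸m]≡n lo) ⟩
        just (rowT x) ∎
        where
        open ≡-Reasoning
        lo = proj₁ (proj₂ (T∈D x x∈))
        hi = proj₁ (proj₂ (proj₂ (T∈D x x∈)))
        T⁻¹-injective : ∀ t → 1 ≤ t → t < 1 + m → T⁻¹ 1 t ≡ T⁻¹ 1 (rowT x) → t ≡ rowT x
        T⁻¹-injective t lo′ hi′ eq =
          trans (sym (rowT-T⁻¹ (first-column lo′ (≤-pred hi′)))) (trans (cong rowT eq) (rowT-T⁻¹ (first-column lo hi)))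
      rowAux≡ (suc k) x x∈ col≡ = begin
        (owner x (layer π (suc k)) >>= rowAux π (suc k))
          ≡⟨ cong (λ z → owner z (layer π (suc k)) >>= rowAux π (suc k)) (sym (T⁻¹-at-col x∈ col≡)) ⟩
        (owner (T⁻¹ (suc (suc k)) j) (layer π (suc k)) >>= rowAux π (suc k))
          ≡⟨ cong (_>>= rowAux π (suc k)) (owner-T⁻¹ k j j∈D) ⟩
        rowAux π (suc k) (T⁻¹ (suc k) j)
          ≡⟨ rowAux≡ k (T⁻¹ (suc k) j) (Entry-T⁻¹ j∈D′) (colT-T⁻¹ j∈D′) ⟩
        just (rowT (T⁻¹ (suc k) j))
          ≡⟨ cong just (rowT-T⁻¹ j∈D′) ⟩
        just (rowT x) ∎
        where
        open ≡-Reasoning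
        x∈D = T∈D x x∈
        j = rowT x
        j∈D : InD α (suc (suc k) , j)
        j∈D = s≤s z≤n , proj₁ (proj₂ x∈D) , proj₁ (proj₂ (proj₂ x∈D)) , subst (_≤ at α j) col≡ (proj₂ (proj₂ (proj₂ x∈D)))
        j∈D′ = weaken-column j∈D

      rowAux-at-colT : ∀ x → Entry x → rowAux π (colT x) x ≡ just (rowT x)
      rowAux-at-colT x x∈ with colT-positive x x∈
      ... | k , col≡ = subst (λ c → rowAux π c x ≡ just (rowT x)) (sym col≡) (rowAux≡ k x x∈ col≡)

      Tπ≡T : ∀ x → Entry x → Tπ π x ≡ just (T x)
      Tπ≡T x x∈ with coord≡ x x∈
      ... | p , eq rewrite eq | rowAux-at-colT x x∈ = refl

      row≡rowT : ∀ x → Entry x → row π x ≡ just (rowT x)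
      row≡rowT x x∈ with coord≡ x x∈
      ... | p , eq rewrite eq = rowAux-at-colT x x∈

      απ≡α : απ n π ≡ α
      απ≡α = begin
        map (λ j → count (λ x → eqMaybe (row π x) j) (oneTo n)) (oneTo (length (layer π 1)))
          ≡⟨ cong (λ l → map (λ j → count (λ x → eqMaybe (row π x) j) (oneTo n)) l) (trans (cong oneTo length≡) (oneTo≡range m)) ⟩
        map (λ j → count (λ x → eqMaybe (row π x) j) (oneTo n)) rows
          ≡⟨ map-cong-∈ _ _ rows (λ {j} j∈ → trans (count-cong _ _ (oneTo n) (λ x∈ → cong (λ r → eqMaybe r j) (row≡rowT _ (∈-oneTo⁻ x∈))))
                                                 (row-size j (row-lower j∈) (row-upper j∈))) ⟩
        map (at α) rows
          ≡⟨ map-at-range α ⟩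
        α ∎
        where
        open ≡-Reasoning
        length≡ : length (layer π 1) ≡ m
        length≡ = trans (cong length (trans (layer≡ 0) (firstLayerBlocks B))) (trans (length-map _ rows) (length-range 1 m))

    module Forward (Tπ≡T : ∀ x → 1 ≤ x → x ≤ n → Tπ π x ≡ just (T x))
                   (layer₁≡ : layer π 1 ≡ map (λ j → (B j , T⁻¹ 1 j)) rows) where

      Tπ-T⁻¹ : ∀ {i j} → InD α (i , j) → Tπ π (T⁻¹ i j) ≡ just (i , j)
      Tπ-T⁻¹ ij∈D = let (lo , hi) = Entry-T⁻¹ ij∈D in trans (Tπ≡T _ lo hi) (cong just (proj₂ (T⁻¹-spec _ _ ij∈D)))

      rowAux-T⁻¹ : ∀ {i j} → InD α (i , j) → rowAux π i (T⁻¹ i j) ≡ just j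
      rowAux-T⁻¹ ij∈D = proj₂ (proj₂ (Tπ-just⁻ π _ (Tπ-T⁻¹ ij∈D)))

      coord-colT : ∀ x → Entry x → Σ ℕ λ p → coord π x ≡ just (colT x , p)
      coord-colT x (lo , hi) = let (p , eq , _) = Tπ-just⁻ π x (Tπ≡T x lo hi) in p , eq

      module ExactLayer (k : ℕ) (blk : ℕ → List ℕ) (I : Invariant (suc k) blk)
                        (layer≡ : layer π (suc k) ≡ layerBlocks (suc k) blk rows) where
        open Layer k blk I using (MaxInBlocks)

        decreasing : Decreasing (layerBlocks (suc k) blk rows)
        decreasing = subst Decreasing layer≡ (chain-decreasing _ (left (suc k)) (Unique-left k))

        -- T⁻¹ (i+1) j is the maximum of the block of layer i it is read off from (owner),
        -- and since it sits in row j that block is the one of row j.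
        maxInBlocks : MaxInBlocks
        maxInBlocks j j∈D with owner (T⁻¹ (suc (suc k)) j) (layer π (suc k)) in owner≡ | rowAux-T⁻¹ j∈D
        ... | just c | rowAux≡ with owner-sound _ (layerBlocks (suc k) blk rows) (trans (sym (cong (owner _) layer≡)) owner≡)
        ...   | b , e∈ , y , ys , refl , max≡ with ∈-layerBlocks⁻ (suc k) blk rows e∈
        ...     | j′ , j′∈ , reach , b≡ , refl = x∈ , ≤x
          where
          j′∈D : InD α (suc k , j′)
          j′∈D = s≤s z≤n , row-lower j′∈ , row-upper j′∈ , reach
          j′≡j : j′ ≡ j
          j′≡j = just-injective (trans (sym (rowAux-T⁻¹ j′∈D)) rowAux≡)
          x∈ : T⁻¹ (suc (suc k)) j ∈ blk j
          x∈ = subst (λ r → _ ∈ blk r) j′≡j (subst (_ ∈_) b≡ (subst (_∈ y ∷ ys) max≡ (max-∈ y ys)))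
          ≤x : All (_≤ T⁻¹ (suc (suc k)) j) (blk j)
          ≤x = subst (λ r → All (_≤ _) (blk r)) j′≡j (subst (All (_≤ _)) b≡ (subst (λ z → All (_≤ z) (y ∷ ys)) max≡ (max-greatest y ys)))
        maxInBlocks j j∈D | nothing | ()

        open Layer.Step k blk I maxInBlocks decreasing using (i⁺; NextLayer; next)
        open NextLayer next

        private
          D⁺ = layerBlocks i⁺ blk⁺ rows
          f = length (iter (suc k) π)
          Unique-D⁺ : Unique (flatten D⁺ ++ leftover)
          Unique-D⁺ = subst Unique left≡⁺ (Unique-left (suc k))
          layer⁺≡ : layer π i⁺ ≡ chain f (flatten D⁺ ++ leftover)
          layer⁺≡ = cong (chain f) left≡⁺

        colT-next : ∀ {x} → x ∈ flatten D⁺ ++ leftover → i⁺ ≤ colT x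
        colT-next x∈ with ∈-++⁻ (flatten D⁺) x∈
        ... | inj₂ x∈left = ≤-trans (n≤1+n _) (proj₁ (proj₂ (leftover-pending x∈left)))
        ... | inj₁ x∈D with ∈-flatten-layerBlocks⁻ i⁺ blk⁺ rows x∈D
        ...   | j , j∈ , reach , inj₁ x∈blk = ≤-trans (n≤1+n _) (proj₁ (proj₂ (inBlock⁺ j (s≤s z≤n , row-lower j∈ , row-upper j∈ , reach) x∈blk)))
        ...   | j , j∈ , reach , inj₂ refl = ≤-reflexive (sym (colT-T⁻¹ (s≤s z≤n , row-lower j∈ , row-upper j∈ , reach)))

        -- A key of layer i⁺ is read off in column i⁺ at the latest, hence has column exactly i⁺.
        keys-layer⊆ : ∀ {x} → x ∈ keys (chain f (flatten D⁺ ++ leftover)) → x ∈ keys D⁺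
        keys-layer⊆ {x} x∈ = subst (_∈ keys D⁺) (T⁻¹-at-col x∈′ colT≡)
            (∈-keys-layerBlocks⁺ i⁺ blk⁺ rows (∈-rows (proj₁ (proj₂ x∈D)) (proj₁ (proj₂ (proj₂ x∈D))))
              (subst (_≤ at α (rowT x)) colT≡ (proj₂ (proj₂ (proj₂ x∈D)))))
          where
          x∈L = keys-chain-⊆ f _ Unique-D⁺ x∈
          x∈′ : Entry x
          x∈′ = ∈-left⇒Entry (suc k) (subst (x ∈_) (sym left≡⁺) x∈L)
          x∈D = T∈D x x∈′
          posIn≡ = posIn-∈ x (layer π i⁺) (subst (λ q → x ∈ keys q) (sym layer⁺≡) x∈)
          coord≡ = coord-colT x x∈′
          colT≤ : colT x ≤ i⁺
          colT≤ = firstJust-least 1 (sc π) (λ i → posIn x (layer π i))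
                    (subst (λ l → firstJust l (λ i → posIn x (layer π i)) ≡ just (colT x , proj₁ coord≡)) (oneTo≡range (sc π)) (proj₂ coord≡))
                    (s≤s z≤n) (proj₂ posIn≡)
          colT≡ : colT x ≡ i⁺
          colT≡ = ≤-antisym colT≤ (colT-next x∈L)

        ⊆keys-layer : ∀ {x} → x ∈ keys D⁺ → x ∈ keys (chain f (flatten D⁺ ++ leftover))
        ⊆keys-layer x∈ with ∈-keys-layerBlocks⁻ i⁺ blk⁺ rows x∈
        ... | j , j∈ , reach , refl with Tπ-just⁻ π (T⁻¹ i⁺ j) (Tπ-T⁻¹ (s≤s z≤n , row-lower j∈ , row-upper j∈ , reach))
        ...   | p , coord≡ , _ = subst (λ q → T⁻¹ i⁺ j ∈ keys q) layer⁺≡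
                (posIn-sound _ (layer π i⁺) (proj₂ (firstJust-sound (oneTo (sc π)) (λ i → posIn (T⁻¹ i⁺ j) (layer π i)) coord≡)))

        exact : chain f (flatten D⁺ ++ leftover) ≡ D⁺ × leftover ≡ []
        exact = chain-determined-by-keys f D⁺ leftover Unique-D⁺ (subst (λ l → length l ≤ f) left≡⁺ (length-left (suc k))) keys-layer⊆ ⊆keys-layer

        next-exact : Σ (ℕ → List ℕ) λ blk⁺ → Invariant i⁺ blk⁺ × layer π i⁺ ≡ layerBlocks i⁺ blk⁺ rows
        next-exact = blk⁺ , invariant⁺ (proj₂ exact) , trans layer⁺≡ (proj₁ exact)

      exactLayers : ∀ k → Σ (ℕ → List ℕ) λ blk → Invariant (suc k) blk × layer π (suc k) ≡ layerBlocks (suc k) blk rows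
      exactLayers zero = B , invariant₁ , trans layer₁≡ (sym (firstLayerBlocks B))
      exactLayers (suc k) with exactLayers k
      ... | blk , I , layer≡ = ExactLayer.next-exact k blk I layer≡

      condB : CondB n α T π
      condB (suc (suc k)) j ij∈D@(_ , lo , hi , reach) (s≤s (s≤s _)) with exactLayers k
      ... | blk , I , layer≡ with Invariant.inBlock I j j∈D′ (proj₁ (ExactLayer.maxInBlocks k blk I layer≡ j ij∈D))
        where j∈D′ = weaken-column ij∈D
      ...   | x∈ , _ , seg≤ , beyond = ∈-Bblock⁺ (suc (suc k)) j _ (Entry-T⁻¹ ij∈D) lo hi seg≤ beyond

  module FromTπ (Tπ≡T : ∀ x → 1 ≤ x → x ≤ n → Tπ π x ≡ just (T x)) (απ≡α : απ n π ≡ α) where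

    length-layer₁ : length (layer π 1) ≡ m
    length-layer₁ = trans (sym (trans (length-map _ (oneTo (length (layer π 1))))
                                      (trans (cong length (oneTo≡range (length (layer π 1)))) (length-range 1 _))))
                          (cong length απ≡α)

    posIn-layer₁ : ∀ j → 1 ≤ j → j < 1 + m → posIn (T⁻¹ 1 j) (layer π 1) ≡ just (suc (j ∸ 1))
    posIn-layer₁ j lo hi = trans (proj₂ (proj₂ (Tπ-just⁻ π _ (trans (Tπ≡T _ (proj₁ T⁻¹∈) (proj₂ T⁻¹∈)) (cong just T≡)))))
                                 (cong just (sym (m+[n∸m]≡n lo)))
      where
      T⁻¹∈ = Entry-T⁻¹ (first-column lo (≤-pred hi))
      T≡ = proj₂ (T⁻¹-spec 1 j (first-column lo (≤-pred hi)))

    keys-layer₁ : keys (layer π 1) ≡ map (T⁻¹ 1) rows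
    keys-layer₁ = keys-from-posIn (T⁻¹ 1) (layer π 1) 1 m length-layer₁ posIn-layer₁

    layer₁≡ : layer π 1 ≡ map (λ j → (blocksFrom (layer π 1) 1 j , T⁻¹ 1 j)) rows
    layer₁≡ = tabulate-by-keys (T⁻¹ 1) (layer π 1) 1 m keys-layer₁

    flatten-layer₁ : flatten (layer π 1) ≡ ρ
    flatten-layer₁ = trans (flatten-chain (length (iter 0 π)) (left 1) (Unique-left 0) (length-left 0)) left1≡ρ

    decomposition : RowDecomposition
    decomposition = blocksFrom (layer π 1) 1 ,
      trans (sym flatten-layer₁) (trans (cong flatten layer₁≡) (flatten-map _ (T⁻¹ 1) rows))

    condA : CondA n α T π
    condA = subst (λ l → map (λ j → Tinv n T (1 , j)) l ⊆ π) (sym (oneTo≡range m))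
              (subst (map (T⁻¹ 1) rows ⊆_) (sym π≡)
                (++⁺ʳ (0 ∷ []) (subst (_⊆ ρ) keys-layer₁ (subst (keys (layer π 1) ⊆_) flatten-layer₁ (keys-⊆-flatten (layer π 1))))))

  module FromConditions (condA : CondA n α T π) (condB : CondB n α T π) where

    first-column⊆ρ : map (T⁻¹ 1) rows ⊆ ρ
    first-column⊆ρ = sublist-drop-last ρ (subst (map (T⁻¹ 1) rows ⊆_) π≡ (subst (λ l → map (T⁻¹ 1) l ⊆ π) (oneTo≡range m) condA)) 0∉
      where
      0∉ : 0 ∉ map (T⁻¹ 1) rows
      0∉ 0∈ with ∈-map⁻ (T⁻¹ 1) 0∈
      ... | j , j∈ , 0≡ = <⇒≱ (subst (1 ≤_) (sym 0≡) (proj₁ (Entry-T⁻¹ (first-column (row-lower j∈) (row-upper j∈))))) z≤n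

    private
      split = sublist-range-decompose (T⁻¹ 1) 1 m ρ first-column⊆ρ
      B = proj₁ split
      E = proj₁ (proj₂ split)
      X = concat (map (λ j → B j ++ T⁻¹ 1 j ∷ []) rows)
      ρ≡X++E : ρ ≡ X ++ E
      ρ≡X++E = proj₂ (proj₂ split)

    -- Every entry is in X: the first column by construction, the others by (b), since
    -- B_{π,T}(i,j,1) lies before T⁻¹(1,j).
    ∈-X : ∀ {y} → Entry y → y ∈ X
    ∈-X {y} y∈ = by-column (m≤n⇒m<n∨m≡n (proj₁ y∈D))
      where
      y∈D = T∈D y y∈
      T⁻¹∈X : T⁻¹ 1 (rowT y) ∈ X
      T⁻¹∈X = ∈-concat-range⁺ (λ j → B j ++ T⁻¹ 1 j ∷ []) 1 m (proj₁ (proj₂ y∈D)) (s≤s (proj₁ (proj₂ (proj₂ y∈D)))) (∈-++⁺ʳ (B (rowT y)) (here refl))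
      π≡X++ : π ≡ X ++ (E ++ 0 ∷ [])
      π≡X++ = trans π≡ (trans (cong (_++ 0 ∷ []) ρ≡X++E) (++-assoc X E _))
      by-column : 1 < colT y ⊎ 1 ≡ colT y → y ∈ X
      by-column (inj₂ 1≡col) = subst (_∈ X) (T⁻¹-at-col y∈ (sym 1≡col)) T⁻¹∈X
      by-column (inj₁ 1<col) = throughIncl-⊆-prefix X (E ++ 0 ∷ []) T⁻¹∈X
        (subst (λ l → y ∈ throughIncl (T⁻¹ 1 (rowT y)) l) π≡X++
          (Bblock⊆throughIncl n α T π (colT y) (rowT y) (subst (_∈ Bblock n α T π (colT y) (rowT y)) (T⁻¹-T y y∈) (condB (colT y) (rowT y) y∈D 1<col))))

    decomposition : RowDecomposition
    decomposition = B , trans ρ≡X++E (trans (cong (X ++_) E≡[]) (++-identityʳ X))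
      where
      E≡[] : E ≡ []
      E≡[] = empty-if-no-members E λ {y} y∈E → Unique-++⇒disjoint X (subst Unique ρ≡X++E Unique-ρ)
               (∈-X (∈-left⇒Entry 0 (subst (y ∈_) (sym (trans left1≡ρ ρ≡X++E)) (∈-++⁺ʳ X y∈E)))) y∈E

lemma4p5 : (n : ℕ) (α : List ℕ) → IsComposition n α →
    (T : ℕ → ℕ × ℕ) → IsLinearExtension n α T →
    (π : List ℕ) → InS′ n π →
    TEqTπ n α T π ⇔ (CondA n α T π × CondB n α T π)
lemma4p5 n α comp T LE π (perm , ρ , π≡) = mk⇔ to from
  where
  open Setting n α comp T LE π ρ perm π≡
  to : TEqTπ n α T π → CondA n α T π × CondB n α T π
  to (Tπ≡T , απ≡α) = condA , Forward.condB Tπ≡T layer₁≡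
    where
    open FromTπ Tπ≡T απ≡α
    open Decomposition (proj₁ decomposition) (proj₂ decomposition)
  from : CondA n α T π × CondB n α T π → TEqTπ n α T π
  from (ca , cb) = (λ x lo hi → Tπ≡T x (lo , hi)) , απ≡α
    where
    open FromConditions ca cb using (decomposition)
    open Decomposition (proj₁ decomposition) (proj₂ decomposition)
    inBblock : ∀ y → Entry y → 2 ≤ colT y → seg y ≤ rowT y × Beyond (colT y ∸ 1) (rowT y) y
    inBblock y y∈ 2≤col = ∈-Bblock⁻ (colT y) (rowT y) y (proj₁ (proj₂ y∈D)) (proj₁ (proj₂ (proj₂ y∈D)))
      (subst (_∈ Bblock n α T π (colT y) (rowT y)) (T⁻¹-T y y∈) (cb (colT y) (rowT y) y∈D 2≤col))
      where y∈D = T∈D y y∈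
    open Backward inBblock
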